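{- Let $n$ be a positive integer and $0\le k\le n$. Let $\mathrm{RInc}_k(2\times n)$ be the set of $2\times n$ arrays $T=(T_{i,j})_{1\le i\le 2,\,1\le j\le n}$ of positive integers such that each row is strictly increasing from left to right, each column is weakly increasing from top to bottom ($T_{1,j}\le T_{2,j}$), and the set of entries of $T$ is exactly $\{1,2,\ldots,2n-k\}$. Then \[ \sum_{T\in \mathrm{RInc}_k(2\times n)} q^{\mathrm{amaj}(T)}=\frac{q^{\,k(k-1)/2}}{[n-k+1]}\begin{bmatrix}2n-k\\ k\end{bmatrix}\begin{bmatrix}2n-2k\\ n-k\end{bmatrix}. \]
   Context: Rows are numbered from top (row 1) to bottom (row 2). For such a two-row array $T$, an integer $i$ is an ascent of $T$ if $i$ occurs in row 2 and $i+1$ occurs in row 1; $A(T)$ is the set of ascents and $\mathrm{amaj}(T)=\sum_{i\in A(T)} i$. Here $[m]=1+q+\cdots+q^{m-1}$, $[m]!=[1][2]\cdots[m]$, and $\begin{bmatrix}a\\ b\end{bmatrix}=\frac{[a]!}{[b]![a-b]!}$ is the $q$-binomial coefficient. -}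

module Defs where

open import Data.Nat using (ℕ; zero; suc; _+_; _*_; _∸_; _^_; _≤_; _<_; _≤?_; _<?_; NonZero; s≤s; z≤n)
import Data.Nat.Properties as ℕP
open import Data.Fin using (Fin) renaming (zero to f0; suc to fs; _<_ to _<ᶠ_; _<?_ to _<ᶠ?_)
open import Data.Fin.Properties using (all?; any?)
open import Data.Vec using (Vec; []; _∷_; lookup)
open import Data.List using (List; []; _∷_; map; concatMap; filter; upTo; cartesianProduct)
open import Data.Nat.ListAction using (sum)
open import Data.Product using (_×_; _,_; ∃; ∃₂; proj₁; proj₂)
open import Data.Integer using (+_)
open import Data.Rational.Unnormalised using (ℚᵘ; _/_)
import Data.Rational.Unnormalised as Q
open import Relation.Nullary using (Dec; yes; no)
open import Relation.Nullary.Decidable using (_×-dec_; _→-dec_)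
open import Relation.Binary.PropositionalEquality using (_≡_; subst; sym)
open import Data.Empty using (⊥-elim)
open import Data.Sum using (_⊎_; inj₁; inj₂; [_,_]′)

-- [m] = 1 + q + ... + q^(m-1)   (written in Horner form: [m+1] = 1 + q [m])
[_]q : ℕ → ℕ → ℕ
[ zero  ]q q = 0
[ suc m ]q q = 1 + q * [ m ]q q

[_]!q : ℕ → ℕ → ℕ
[ zero  ]!q q = 1
[ suc m ]!q q = [ suc m ]q q * [ m ]!q q

fact-nonZero : ∀ {m q} → NonZero ([ m ]!q q)
fact-nonZero {zero}  {q} = _
fact-nonZero {suc m} {q} = ℕP.m*n≢0 ([ suc m ]q q) ([ m ]!q q) {{_}} {{fact-nonZero {m} {q}}}

prod-nonZero : ∀ {a b q} → NonZero ([ a ]!q q * [ b ]!q q)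
prod-nonZero {a} {b} {q} = ℕP.m*n≢0 ([ a ]!q q) ([ b ]!q q) {{fact-nonZero {a} {q}}} {{fact-nonZero {b} {q}}}

-- q-binomial [a choose b] = [a]! / ([b]! [a-b]!)  (as a rational number, for b ≤ a)
qbinom : ℕ → ℕ → ℕ → ℚᵘ
qbinom a b q = _/_ (+ [ a ]!q q) ([ b ]!q q * [ a ∸ b ]!q q) {{prod-nonZero {b} {a ∸ b} {q}}}

Array : ℕ → Set
Array n = Vec (Vec ℕ n) 2

row1 row2 : ∀ {n} → Array n → Vec ℕ n
row1 T = lookup T f0
row2 T = lookup T (fs f0)

entry : ∀ {n} → Array n → Fin 2 → Fin n → ℕ
entry T i j = lookup (lookup T i) j

StrictlyIncreasing : ∀ {n} → Vec ℕ n → Set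
StrictlyIncreasing {n} r = (j j′ : Fin n) → j <ᶠ j′ → lookup r j < lookup r j′

RInc : (n k : ℕ) → Array n → Set
RInc n k T =
  StrictlyIncreasing (row1 T) × StrictlyIncreasing (row2 T)
  × ((j : Fin n) → lookup (row1 T) j ≤ lookup (row2 T) j)
  × ((i : Fin 2) (j : Fin n) → 1 ≤ entry T i j × entry T i j ≤ 2 * n ∸ k)
  × ((x : ℕ) → 1 ≤ x → x ≤ 2 * n ∸ k → ∃₂ λ i j → entry T i j ≡ x)

strictInc? : ∀ {n} (r : Vec ℕ n) → Dec (StrictlyIncreasing r)
strictInc? r = all? λ j → all? λ j′ → (j <ᶠ? j′) →-dec (lookup r j <? lookup r j′)

Occurs : ∀ {n} → ℕ → Vec ℕ n → Set
Occurs {n} x r = ∃ λ (j : Fin n) → lookup r j ≡ x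

occurs? : ∀ {n} (x : ℕ) (r : Vec ℕ n) → Dec (Occurs x r)
occurs? x r = any? λ j → lookup r j ℕP.≟ x

boundedDec : (P : ℕ → Set) → (∀ x → Dec (P x)) → (m : ℕ) →
             Dec ((x : ℕ) → 1 ≤ x → x ≤ m → P x)
boundedDec P P? zero = yes λ { x 1≤x x≤0 → ⊥-elim (ℕP.<⇒≱ 1≤x x≤0) }
boundedDec P P? (suc m) with boundedDec P P? m | P? (suc m)
... | no ¬h | _ = no λ h → ¬h λ x a b → h x a (ℕP.m≤n⇒m≤1+n b)
... | yes _ | no ¬p = no λ h → ¬p (h (suc m) (s≤s z≤n) ℕP.≤-refl)
... | yes h | yes p = yes λ x a b → [ (λ x≤m → h x a x≤m) , (λ x≡ → subst P (sym x≡) p) ]′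
                                      (≤-split x b)
  where
  ≤-split : ∀ x → x ≤ suc m → (x ≤ m) ⊎ (x ≡ suc m)
  ≤-split x b with ℕP.m≤n⇒m<n∨m≡n b
  ... | inj₁ x<1+m = inj₁ (ℕP.≤-pred x<1+m)
  ... | inj₂ e = inj₂ e

RInc? : (n k : ℕ) (T : Array n) → Dec (RInc n k T)
RInc? n k T =
  strictInc? (row1 T) ×-dec strictInc? (row2 T)
  ×-dec all? (λ j → lookup (row1 T) j ≤? lookup (row2 T) j)
  ×-dec all? (λ i → all? λ j → (1 ≤? entry T i j) ×-dec (entry T i j ≤? 2 * n ∸ k))
  ×-dec boundedDec (λ x → ∃₂ λ i j → entry T i j ≡ x)
           (λ x → any? λ i → any? λ j → entry T i j ℕP.≟ x) (2 * n ∸ k)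

range : ℕ → List ℕ
range m = map suc (upTo m)

vecsOver : (n : ℕ) → List ℕ → List (Vec ℕ n)
vecsOver zero    xs = [] ∷ []
vecsOver (suc n) xs = concatMap (λ x → map (x ∷_) (vecsOver n xs)) xs

arraysOver : (n m : ℕ) → List (Array n)
arraysOver n m = map (λ p → proj₁ p ∷ proj₂ p ∷ []) (cartesianProduct (vecsOver n (range m)) (vecsOver n (range m)))

-- RInc_k(2 × n) as an explicit duplicate-free list
RIncList : (n k : ℕ) → List (Array n)
RIncList n k = filter (RInc? n k) (arraysOver n (2 * n ∸ k))

IsAscent : ∀ {n} → Array n → ℕ → Set
IsAscent T i = Occurs i (row2 T) × Occurs (suc i) (row1 T)

isAscent? : ∀ {n} (T : Array n) (i : ℕ) → Dec (IsAscent T i)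
isAscent? T i = occurs? i (row2 T) ×-dec occurs? (suc i) (row1 T)

-- every ascent i occurs in row 2, hence i ≤ (sum of row-2 entries); we list
-- the ascent set A(T) by filtering 0, 1, ..., (sum of row 2).
rowSum : ∀ {n} → Vec ℕ n → ℕ
rowSum [] = 0
rowSum (x ∷ r) = x + rowSum r

ascents : ∀ {n} → Array n → List ℕ
ascents T = filter (isAscent? T) (upTo (suc (rowSum (row2 T))))

amaj : ∀ {n} → Array n → ℕ
amaj T = sum (ascents T)

amajGF : (n k q : ℕ) → ℕ
amajGF n k q = sum (map (λ T → q ^ amaj T) (RIncList n k))

-- Build T ∈ RInc_k(2 × n) by inserting 1, 2, …, 2n − k one at a time. After N steps one has two strictly
-- increasing rows of lengths u ≥ d with weakly increasing columns and entries exactly 1, …, N, and N + 1 is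
-- appended to row 1, to row 2 (if row 1 is longer) or to both. It creates the ascent N exactly when it enters
-- row 1 while N lies in row 2, so the amaj-generating functions of these partial arrays, split according to
-- whether the largest entry lies in row 2, satisfy linear recurrences. With b entries only in row 2, b + e only
-- in row 1 and c in both rows (b + c ≥ 1, and 2b + e + c = M + 1 entries in all) they are solved by
--   q^(c choose 2) [M]! q^(2b+c) [e] / ([b]! [c]! [b+e]!)                  (largest entry only in row 1),
--   q^(c choose 2) [M]! ([M+1] + q^(b+1) [e] [b+c−1]) / ([b]! [c]! [b+e+1]!)  (largest entry in row 2).
-- Checking this reduces to four identities between q-integers, which for q = 1 + p become polynomial
-- identities in p, [b], [e], [c] because q^x = 1 + p [x]. The arrays in RInc_k are those with e = 0,
-- b = n − k and c = k, where the second formula is the claimed one.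

module Submission where

open import Defs
open import Data.Nat
open import Data.Nat.Properties
open import Data.Nat.DivMod using (_/_; m*n/n≡m; +-distrib-/-∣ˡ)
open import Data.Nat.Divisibility using (divides-refl)
open import Data.Nat.ListAction using (sum)
open import Data.Nat.Tactic.RingSolver using (solve; solve-∀)
open import Data.List using (List; []; _∷_; map)
open import Data.Integer using (+_) renaming (_*_ to _ℤ*_)
import Data.Integer.Properties as ℤ
open import Data.Rational.Unnormalised using (_≃_; *≡*) renaming (_/_ to _/ℚ_; _*_ to _*ℚ_)
open import Data.Product using (_×_; _,_; proj₁; proj₂)
open import Function using (_∘_)
open import Relation.Nullary using (¬_)
open import Relation.Binary.PropositionalEquality
open ≡-Reasoning

pow-qint : ∀ p x → suc p ^ x ≡ 1 + p * [ x ]q (suc p)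
pow-qint p zero = cong suc (sym (*-zeroʳ p))
pow-qint p (suc x) rewrite pow-qint p x with [ x ]q (suc p)
... | X = solve (p ∷ X ∷ [])

qint-+ : ∀ p x y → [ x + y ]q (suc p) ≡ [ x ]q (suc p) + (1 + p * [ x ]q (suc p)) * [ y ]q (suc p)
qint-+ p zero    y with [ y ]q (suc p)
... | Y = solve (p ∷ Y ∷ [])
qint-+ p (suc x) y rewrite qint-+ p x y with [ x ]q (suc p) | [ y ]q (suc p)
... | X | Y = solve (p ∷ X ∷ Y ∷ [])

core₁ : (q b e c : ℕ) → ℕ
core₁ q b e c = q ^ (b + b + c) * [ e ]q q

core₂ : (q b e s : ℕ) → ℕ
core₂ q b e s = [ suc (b + e + s) ]q q + q ^ suc b * [ e ]q q * [ s ]q q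

-- At q = 0 every q-integer is 0 or 1 and the identities are checked case by case. For q = 1 + p, pow-qint and
-- qint-+ express all powers of q and all q-integers through p, [b], [e], [c], leaving a polynomial identity.
core₁-step : ∀ q b e c s → b + c ≡ suc s →
  [ suc (b + e) ]q q * core₁ q b e c + q ^ (b + b + e + c) * core₂ q b e s
    ≡ [ suc (b + e + s) ]q q * core₁ q b (suc e) c
core₁-step zero (suc b) zero zero ._ refl = refl
core₁-step zero (suc b) zero (suc c) ._ refl = refl
core₁-step zero (suc b) (suc e) zero ._ refl = refl
core₁-step zero (suc b) (suc e) (suc c) ._ refl = refl
core₁-step zero zero zero (suc c) ._ refl = refl
core₁-step zero zero (suc e) (suc c) ._ refl = refl
core₁-step (suc p) (suc b) e c ._ refl
  rewrite pow-qint p (b + suc b + e + c) | pow-qint p (b + suc b + c)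
        | qint-+ p (b + suc b + e) c | qint-+ p (b + suc b) e | qint-+ p (b + suc b) c
        | qint-+ p b (suc b) | qint-+ p (b + e) (b + c) | qint-+ p b e
        | qint-+ p b c | pow-qint p b
  with [ b ]q (suc p) | [ e ]q (suc p) | [ c ]q (suc p)
... | B | E | C = solve (p ∷ B ∷ E ∷ C ∷ [])
core₁-step (suc p) zero e (suc c) ._ refl
  rewrite pow-qint p (e + suc c) | qint-+ p e (suc c) | qint-+ p e c | pow-qint p c
  with [ e ]q (suc p) | [ c ]q (suc p)
... | E | C = solve (p ∷ E ∷ C ∷ [])

core₂-step-b≡0 : ∀ q e c →
  [ suc (suc c) ]q q * core₁ q 0 (suc e) (suc c) ≡ q ^ suc c * core₂ q 0 e (suc c)
core₂-step-b≡0 zero zero zero = refl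
core₂-step-b≡0 zero zero (suc c) = refl
core₂-step-b≡0 zero (suc e) zero = refl
core₂-step-b≡0 zero (suc e) (suc c) = refl
core₂-step-b≡0 (suc p) e c
  rewrite qint-+ p e (suc c) | pow-qint p c
  with [ e ]q (suc p) | [ c ]q (suc p)
... | E | C = solve (p ∷ E ∷ C ∷ [])

core₂-step-c≡0 : ∀ q b e →
  [ suc (suc b) ]q q * ([ suc (suc (suc b + e)) ]q q * core₁ q (suc b) (suc e) 0 + core₂ q (suc b) (suc e) (b + 0))
    ≡ [ suc (suc b + suc e + (b + 0)) ]q q * core₂ q (suc (suc b)) e (suc b + 0)
core₂-step-c≡0 zero zero zero = refl
core₂-step-c≡0 zero zero (suc e) = refl
core₂-step-c≡0 zero (suc b) zero = refl
core₂-step-c≡0 zero (suc b) (suc e) = refl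
core₂-step-c≡0 (suc p) b e
  rewrite +-identityʳ b | +-identityʳ (b + suc b) | pow-qint p (b + suc b)
        | qint-+ p (b + e) (suc b) | qint-+ p (b + suc e) b | qint-+ p b (suc b)
        | qint-+ p b e | qint-+ p b (suc e) | pow-qint p b
  with [ b ]q (suc p) | [ e ]q (suc p)
... | B | E = solve (p ∷ B ∷ E ∷ [])

core₂-step : ∀ q b e c → let M = suc (b + suc e + (b + c)) in
  [ suc b ]q q * ([ suc (suc (b + e)) ]q q * (q ^ c * core₁ q b (suc e) (suc c)) + q ^ c * core₂ q b (suc e) (b + c))
    + [ suc c ]q q * ([ M ]q q * core₁ q (suc b) (suc e) c)
    ≡ q ^ c * ([ M ]q q * core₂ q (suc b) e (b + suc c))
core₂-step zero zero zero zero = refl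
core₂-step zero zero zero (suc c) = refl
core₂-step zero zero (suc e) zero = refl
core₂-step zero zero (suc e) (suc c) = refl
core₂-step zero (suc b) zero zero = refl
core₂-step zero (suc b) zero (suc c) = refl
core₂-step zero (suc b) (suc e) zero = refl
core₂-step zero (suc b) (suc e) (suc c) = refl
core₂-step (suc p) b e c
  rewrite pow-qint p (b + b + suc c) | pow-qint p (b + suc b + c)
        | qint-+ p (b + b) (suc c) | qint-+ p (b + suc b) c | qint-+ p b b | qint-+ p b (suc b)
        | qint-+ p (b + e) (b + suc c) | qint-+ p (b + suc e) (b + c)
        | qint-+ p b e | qint-+ p b (suc e) | qint-+ p b (suc c) | qint-+ p b c
        | pow-qint p b | pow-qint p c
  with [ b ]q (suc p) | [ e ]q (suc p) | [ c ]q (suc p)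
... | B | E | C = solve (p ∷ B ∷ E ∷ C ∷ [])

cong₃ : ∀ (f : ℕ → ℕ → ℕ → ℕ) {x y z x′ y′ z′} → x ≡ x′ → y ≡ y′ → z ≡ z′ → f x y z ≡ f x′ y′ z′
cong₃ f refl refl refl = refl

-- Substituting the closed forms t · g · core into the recurrences: the common factor t · g comes out.
factor₁-step : ∀ t g x z y w m z′ → x * z + y * w ≡ m * z′ → x * (t * g * z) + y * (t * g * w) ≡ t * (m * g) * z′
factor₁-step t g x z y w m z′ eq = begin
  x * (t * g * z) + y * (t * g * w) ≡⟨ solve (t ∷ g ∷ x ∷ z ∷ y ∷ w ∷ []) ⟩
  t * g * (x * z + y * w)           ≡⟨ cong (t * g *_) eq ⟩
  t * g * (m * z′)                  ≡⟨ solve (t ∷ g ∷ m ∷ z′ ∷ []) ⟩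
  t * (m * g) * z′                  ∎

factor₂-step-b≡0 : ∀ t g x z y w → x * z ≡ y * w → x * (t * g * z) ≡ y * t * g * w
factor₂-step-b≡0 t g x z y w eq = begin
  x * (t * g * z) ≡⟨ solve (t ∷ g ∷ x ∷ z ∷ []) ⟩
  t * g * (x * z) ≡⟨ cong (t * g *_) eq ⟩
  t * g * (y * w) ≡⟨ solve (t ∷ g ∷ y ∷ w ∷ []) ⟩
  y * t * g * w   ∎

factor₂-step-c≡0 : ∀ t g x m′ z w m w′ → x * (m′ * z + w) ≡ m * w′ → x * (m′ * (t * g * z) + t * g * w) ≡ t * (m * g) * w′
factor₂-step-c≡0 t g x m′ z w m w′ eq = begin
  x * (m′ * (t * g * z) + t * g * w) ≡⟨ solve (t ∷ g ∷ x ∷ m′ ∷ z ∷ w ∷ []) ⟩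
  t * g * (x * (m′ * z + w))         ≡⟨ cong (t * g *_) eq ⟩
  t * g * (m * w′)                   ≡⟨ solve (t ∷ g ∷ m ∷ w′ ∷ []) ⟩
  t * (m * g) * w′                   ∎

factor₂-step : ∀ t g x m′ y z₁ w₁ x′ m z₃ w →
  x * (m′ * (y * z₁) + y * w₁) + x′ * (m * z₃) ≡ y * (m * w) →
  x * (m′ * (y * t * g * z₁) + y * t * g * w₁) + x′ * (t * (m * g) * z₃) ≡ y * t * (m * g) * w
factor₂-step t g x m′ y z₁ w₁ x′ m z₃ w eq = begin
  x * (m′ * (y * t * g * z₁) + y * t * g * w₁) + x′ * (t * (m * g) * z₃) ≡⟨ solve (t ∷ g ∷ x ∷ m′ ∷ y ∷ z₁ ∷ w₁ ∷ x′ ∷ m ∷ z₃ ∷ []) ⟩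
  t * g * (x * (m′ * (y * z₁) + y * w₁) + x′ * (m * z₃))                 ≡⟨ cong (t * g *_) eq ⟩
  t * g * (y * (m * w))                                                   ≡⟨ solve (t ∷ g ∷ y ∷ m ∷ w ∷ []) ⟩
  y * t * (m * g) * w                                                     ∎

module Enumeration where

  open import Data.Fin using (Fin; toℕ; inject₁; fromℕ; fromℕ<) renaming (zero to f0; suc to fs)
  open import Data.Fin.Properties using (toℕ-inject₁; toℕ-fromℕ; toℕ<n; toℕ-fromℕ<; toℕ-injective)
  open import Data.Vec using (Vec; []; _∷_; lookup; _∷ʳ_; initLast)
  open import Data.Vec.Properties using (∷ʳ-injective; ∷-injective; ∷-injectiveʳ)
  open import Data.List using (_++_; filter; upTo)
  open import Data.List.Properties
    using (upTo-∷ʳ; filter-++; filter-accept; filter-reject; map-++; map-∘; map-cong-local; ++-identityʳ)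
  open import Data.Nat.ListAction.Properties using (sum-++; sum-↭)
  open import Data.List.Relation.Unary.All as All using (All; []; _∷_)
  import Data.List.Relation.Unary.All.Properties as All
  open import Data.List.Relation.Unary.AllPairs as AllPairs using ([]; _∷_)
  import Data.List.Relation.Unary.AllPairs.Properties as AllPairs
  open import Data.List.Relation.Unary.Any using (here)
  open import Data.List.Relation.Unary.Unique.Propositional using (Unique)
  import Data.List.Relation.Unary.Unique.Propositional.Properties as Unique
  open import Data.List.Membership.Propositional using (_∈_)
  open import Data.List.Membership.Propositional.Properties
    using (∈-++⁺ˡ; ∈-++⁺ʳ; ∈-map⁺; ∈-map⁻; ∈-upTo⁺; ∈-filter⁺; ∈-filter⁻; ∈-cartesianProduct⁺; ∈-concat⁺′)
  open import Data.List.Membership.Propositional.Properties.WithK using (unique∧set⇒bag)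
  open import Data.List.Relation.Binary.BagAndSetEquality using (∼bag⇒↭)
  open import Data.List.Relation.Binary.Permutation.Propositional using (_↭_)
  import Data.List.Relation.Binary.Permutation.Propositional.Properties as ↭
  open import Data.Product using (∃; ∃₂)
  open import Data.Sum using (_⊎_; inj₁; inj₂; [_,_]′)
  open import Data.Empty using (⊥-elim)
  open import Function using (mk⇔)
  open import Relation.Nullary using (Dec; yes; no)
  open import Relation.Nullary.Decidable using (_×-dec_)
  open import Relation.Unary using (Decidable)

  onlyIf : ∀ {A P : Set} → Dec P → List A → List A
  onlyIf (yes _) xs = xs
  onlyIf (no _)  _  = []

  All-onlyIf : ∀ {A P : Set} {Q : A → Set} (p? : Dec P) {xs} → All Q xs → All Q (onlyIf p? xs)
  All-onlyIf (yes _) qs = qs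
  All-onlyIf (no _)  _  = []

  onlyIf⊆ : ∀ {A P : Set} (p? : Dec P) {xs : List A} {x} → x ∈ onlyIf p? xs → x ∈ xs
  onlyIf⊆ (yes _) x∈xs = x∈xs

  Unique-onlyIf : ∀ {A P : Set} (p? : Dec P) {xs : List A} → Unique xs → Unique (onlyIf p? xs)
  Unique-onlyIf (yes _) u = u
  Unique-onlyIf (no _)  _ = []

  onlyIf-yes : ∀ {A P : Set} (p? : Dec P) {xs : List A} → P → onlyIf p? xs ≡ xs
  onlyIf-yes (yes _) _ = refl
  onlyIf-yes (no ¬p) p = ⊥-elim (¬p p)

  ∈-onlyIf : ∀ {A P : Set} (p? : Dec P) {xs : List A} {x} → P → x ∈ xs → x ∈ onlyIf p? xs
  ∈-onlyIf (yes _) p x∈xs = x∈xs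
  ∈-onlyIf (no ¬p) p _    = ⊥-elim (¬p p)

  filter-cong : ∀ {A : Set} {P Q : A → Set} (P? : Decidable P) (Q? : Decidable Q) {xs} →
    All (λ x → (P x → Q x) × (Q x → P x)) xs → filter P? xs ≡ filter Q? xs
  filter-cong P? Q? [] = refl
  filter-cong P? Q? {x ∷ _} ((P→Q , Q→P) ∷ rest) with P? x | Q? x
  ... | yes _  | yes _  = cong (x ∷_) (filter-cong P? Q? rest)
  ... | yes Px | no ¬Qx = ⊥-elim (¬Qx (P→Q Px))
  ... | no ¬Px | yes Qx = ⊥-elim (¬Px (Q→P Qx))
  ... | no _   | no _   = filter-cong P? Q? rest

  module _ {P : ℕ → Set} (P? : Decidable P) where
    filter-upTo-+ : ∀ A → (∀ {i} → P i → i < A) → ∀ m → filter P? (upTo (A + m)) ≡ filter P? (upTo A)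
    filter-upTo-+ A below zero    = cong (filter P? ∘ upTo) (+-identityʳ A)
    filter-upTo-+ A below (suc m) = begin
      filter P? (upTo (A + suc m))                       ≡⟨ cong (filter P? ∘ upTo) (+-suc A m) ⟩
      filter P? (upTo (suc (A + m)))                     ≡⟨ cong (filter P?) (sym (upTo-∷ʳ (A + m))) ⟩
      filter P? (upTo (A + m) ++ A + m ∷ [])             ≡⟨ filter-++ P? (upTo (A + m)) (A + m ∷ []) ⟩
      filter P? (upTo (A + m)) ++ filter P? (A + m ∷ []) ≡⟨ cong (filter P? (upTo (A + m)) ++_) (filter-reject P? (λ p → <⇒≱ (below p) (m≤m+n A m))) ⟩
      filter P? (upTo (A + m)) ++ []                     ≡⟨ ++-identityʳ _ ⟩
      filter P? (upTo (A + m))                           ≡⟨ filter-upTo-+ A below m ⟩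
      filter P? (upTo A)                                 ∎

    filter-upTo-bounds : ∀ A B → (∀ {i} → P i → i < A) → (∀ {i} → P i → i < B) → filter P? (upTo A) ≡ filter P? (upTo B)
    filter-upTo-bounds A B below-A below-B = begin
      filter P? (upTo A)       ≡⟨ sym (filter-upTo-+ A below-A B) ⟩
      filter P? (upTo (A + B)) ≡⟨ cong (filter P? ∘ upTo) (+-comm A B) ⟩
      filter P? (upTo (B + A)) ≡⟨ filter-upTo-+ B below-B A ⟩
      filter P? (upTo B)       ∎

  sum-map-*ˡ : ∀ {A : Set} c (f : A → ℕ) xs → sum (map (λ x → c * f x) xs) ≡ c * sum (map f xs)
  sum-map-*ˡ c f []       = sym (*-zeroʳ c)
  sum-map-*ˡ c f (x ∷ xs) = trans (cong (_+_ (c * f x)) (sum-map-*ˡ c f xs)) (sym (*-distribˡ-+ c (f x) _))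

  lookup-∷ʳ-inject₁ : ∀ {A : Set} {n} (xs : Vec A n) x j → lookup (xs ∷ʳ x) (inject₁ j) ≡ lookup xs j
  lookup-∷ʳ-inject₁ (y ∷ xs) x f0     = refl
  lookup-∷ʳ-inject₁ (y ∷ xs) x (fs j) = lookup-∷ʳ-inject₁ xs x j

  lookup-∷ʳ-fromℕ : ∀ {A : Set} {n} (xs : Vec A n) x → lookup (xs ∷ʳ x) (fromℕ n) ≡ x
  lookup-∷ʳ-fromℕ []       x = refl
  lookup-∷ʳ-fromℕ (y ∷ xs) x = lookup-∷ʳ-fromℕ xs x

  inject₁-or-fromℕ : ∀ {n} (j : Fin (suc n)) → (∃ λ j₀ → j ≡ inject₁ j₀) ⊎ j ≡ fromℕ n
  inject₁-or-fromℕ {zero}  f0     = inj₂ refl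
  inject₁-or-fromℕ {suc n} f0     = inj₁ (f0 , refl)
  inject₁-or-fromℕ {suc n} (fs j) with inject₁-or-fromℕ j
  ... | inj₁ (j₀ , refl) = inj₁ (fs j₀ , refl)
  ... | inj₂ refl        = inj₂ refl

  toℕ-inject₁<toℕ-fromℕ : ∀ {n} (j : Fin n) → toℕ (inject₁ j) < toℕ (fromℕ n)
  toℕ-inject₁<toℕ-fromℕ {n} j rewrite toℕ-inject₁ j | toℕ-fromℕ n = toℕ<n j

  Occurs-∷ʳ⁻ : ∀ {n x y} (xs : Vec ℕ n) → Occurs x (xs ∷ʳ y) → Occurs x xs ⊎ x ≡ y
  Occurs-∷ʳ⁻ {y = y} xs (j , e) with inject₁-or-fromℕ j
  ... | inj₁ (j₀ , refl) = inj₁ (j₀ , trans (sym (lookup-∷ʳ-inject₁ xs y j₀)) e)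
  ... | inj₂ refl        = inj₂ (trans (sym e) (lookup-∷ʳ-fromℕ xs y))

  Occurs-∷ʳ⁺ : ∀ {n x y} (xs : Vec ℕ n) → Occurs x xs → Occurs x (xs ∷ʳ y)
  Occurs-∷ʳ⁺ {y = y} xs (j , e) = inject₁ j , trans (lookup-∷ʳ-inject₁ xs y j) e

  Occurs-∷ʳ-last : ∀ {n} (xs : Vec ℕ n) y → Occurs y (xs ∷ʳ y)
  Occurs-∷ʳ-last {n} xs y = fromℕ n , lookup-∷ʳ-fromℕ xs y

  StrictlyIncreasing-init : ∀ {n} (xs : Vec ℕ n) x → StrictlyIncreasing (xs ∷ʳ x) → StrictlyIncreasing xs
  StrictlyIncreasing-init xs x inc j j′ j<j′ =
    subst₂ _<_ (lookup-∷ʳ-inject₁ xs x j) (lookup-∷ʳ-inject₁ xs x j′)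
      (inc (inject₁ j) (inject₁ j′) (subst₂ _<_ (sym (toℕ-inject₁ j)) (sym (toℕ-inject₁ j′)) j<j′))

  StrictlyIncreasing-last : ∀ {n} (xs : Vec ℕ n) x → StrictlyIncreasing (xs ∷ʳ x) → ∀ j → lookup xs j < x
  StrictlyIncreasing-last {n} xs x inc j =
    subst₂ _<_ (lookup-∷ʳ-inject₁ xs x j) (lookup-∷ʳ-fromℕ xs x) (inc (inject₁ j) (fromℕ n) (toℕ-inject₁<toℕ-fromℕ j))

  StrictlyIncreasing-∷ʳ : ∀ {n} (xs : Vec ℕ n) x →
    StrictlyIncreasing xs → (∀ j → lookup xs j < x) → StrictlyIncreasing (xs ∷ʳ x)
  StrictlyIncreasing-∷ʳ xs x inc below j j′ j<j′ with inject₁-or-fromℕ j | inject₁-or-fromℕ j′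
  ... | inj₁ (j₀ , refl) | inj₁ (j₁ , refl)
    rewrite lookup-∷ʳ-inject₁ xs x j₀ | lookup-∷ʳ-inject₁ xs x j₁
    = inc j₀ j₁ (subst₂ _<_ (toℕ-inject₁ j₀) (toℕ-inject₁ j₁) j<j′)
  ... | inj₁ (j₀ , refl) | inj₂ refl
    rewrite lookup-∷ʳ-inject₁ xs x j₀ | lookup-∷ʳ-fromℕ xs x = below j₀
  ... | inj₂ refl | inj₁ (j₁ , refl) = ⊥-elim (<-asym j<j′ (toℕ-inject₁<toℕ-fromℕ j₁))
  ... | inj₂ refl | inj₂ refl        = ⊥-elim (<-irrefl refl j<j′)

  -- Partial arrays

  InRange : ∀ {n} → ℕ → Vec ℕ n → Set
  InRange {n} N r = (j : Fin n) → 1 ≤ lookup r j × lookup r j ≤ N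

  InRange-weaken : ∀ {n N} (r : Vec ℕ n) → InRange N r → InRange (suc N) r
  InRange-weaken r inr j = proj₁ (inr j) , m≤n⇒m≤1+n (proj₂ (inr j))

  InRange-∷ʳ : ∀ {n N} (xs : Vec ℕ n) → InRange N xs → InRange (suc N) (xs ∷ʳ suc N)
  InRange-∷ʳ {N = N} xs inr j with inject₁-or-fromℕ j
  ... | inj₁ (j₀ , refl) rewrite lookup-∷ʳ-inject₁ xs (suc N) j₀ = InRange-weaken xs inr j₀
  ... | inj₂ refl        rewrite lookup-∷ʳ-fromℕ xs (suc N) = s≤s z≤n , ≤-refl

  InRange-init : ∀ {n N} (xs : Vec ℕ n) x →
    StrictlyIncreasing (xs ∷ʳ x) → InRange (suc N) (xs ∷ʳ x) → InRange N xs
  InRange-init {n} {N} xs x inc inr j =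
    subst (1 ≤_) (lookup-∷ʳ-inject₁ xs x j) (proj₁ (inr (inject₁ j))) ,
    ≤-pred (≤-trans (StrictlyIncreasing-last xs x inc j) (subst (_≤ suc N) (lookup-∷ʳ-fromℕ xs x) (proj₂ (inr (fromℕ n)))))

  InRange-without-top : ∀ {n N} (r : Vec ℕ n) → InRange (suc N) r → ¬ Occurs (suc N) r → InRange N r
  InRange-without-top r inr ¬top j with m≤n⇒m<n∨m≡n (proj₂ (inr j))
  ... | inj₁ x<1+N = proj₁ (inr j) , ≤-pred x<1+N
  ... | inj₂ x≡1+N = ⊥-elim (¬top (j , x≡1+N))

  InRange⇒¬Occurs-suc : ∀ {n N} (r : Vec ℕ n) → InRange N r → ¬ Occurs (suc N) r
  InRange⇒¬Occurs-suc r inr (j , e) = <-irrefl e (s≤s (proj₂ (inr j)))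

  last≡max : ∀ {n M} (xs : Vec ℕ n) x →
    StrictlyIncreasing (xs ∷ʳ x) → InRange M (xs ∷ʳ x) → Occurs M (xs ∷ʳ x) → x ≡ M
  last≡max {n} {M} xs x inc inr (j , e) with inject₁-or-fromℕ j
  ... | inj₂ refl        = trans (sym (lookup-∷ʳ-fromℕ xs x)) e
  ... | inj₁ (j₀ , refl) = ⊥-elim (<⇒≱ (subst (_< x) (trans (sym (lookup-∷ʳ-inject₁ xs x j₀)) e)
                                                       (StrictlyIncreasing-last xs x inc j₀))
                                         (subst (_≤ M) (lookup-∷ʳ-fromℕ xs x) (proj₂ (inr (fromℕ n)))))

  Columns : ∀ {u d} → Vec ℕ u → Vec ℕ d → Set
  Columns {u} {d} r₁ r₂ = (j : Fin u) (j′ : Fin d) → toℕ j ≡ toℕ j′ → lookup r₁ j ≤ lookup r₂ j′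

  Columns-init₁ : ∀ {u d} (xs : Vec ℕ u) x (r₂ : Vec ℕ d) → Columns (xs ∷ʳ x) r₂ → Columns xs r₂
  Columns-init₁ xs x r₂ cols j j′ e =
    subst (_≤ lookup r₂ j′) (lookup-∷ʳ-inject₁ xs x j) (cols (inject₁ j) j′ (trans (toℕ-inject₁ j) e))

  Columns-init₂ : ∀ {u d} (r₁ : Vec ℕ u) (ys : Vec ℕ d) y → Columns r₁ (ys ∷ʳ y) → Columns r₁ ys
  Columns-init₂ r₁ ys y cols j j′ e =
    subst (lookup r₁ j ≤_) (lookup-∷ʳ-inject₁ ys y j′) (cols j (inject₁ j′) (trans e (sym (toℕ-inject₁ j′))))

  Columns-∷ʳ₁ : ∀ {u d} (xs : Vec ℕ u) x (r₂ : Vec ℕ d) → d ≤ u → Columns xs r₂ → Columns (xs ∷ʳ x) r₂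
  Columns-∷ʳ₁ {u} xs x r₂ d≤u cols j j′ e with inject₁-or-fromℕ j
  ... | inj₁ (j₀ , refl) =
    subst (_≤ lookup r₂ j′) (sym (lookup-∷ʳ-inject₁ xs x j₀)) (cols j₀ j′ (trans (sym (toℕ-inject₁ j₀)) e))
  ... | inj₂ refl = ⊥-elim (<-irrefl (trans (sym e) (toℕ-fromℕ u)) (<-≤-trans (toℕ<n j′) d≤u))

  Columns-∷ʳ₂ : ∀ {u d} (r₁ : Vec ℕ u) (ys : Vec ℕ d) y →
    (∀ j → lookup r₁ j ≤ y) → Columns r₁ ys → Columns r₁ (ys ∷ʳ y)
  Columns-∷ʳ₂ r₁ ys y below cols j j′ e with inject₁-or-fromℕ j′
  ... | inj₁ (j₁ , refl) =
    subst (lookup r₁ j ≤_) (sym (lookup-∷ʳ-inject₁ ys y j₁)) (cols j j₁ (trans e (toℕ-inject₁ j₁)))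
  ... | inj₂ refl = subst (lookup r₁ j ≤_) (sym (lookup-∷ʳ-fromℕ ys y)) (below j)

  -- Otherwise the new last entry suc N of row 1 would lie above an entry ≤ N of row 2.
  Columns⇒length : ∀ {u d N} (xs : Vec ℕ u) (r₂ : Vec ℕ d) →
    d ≤ suc u → Columns (xs ∷ʳ suc N) r₂ → InRange N r₂ → d ≤ u
  Columns⇒length {u} {d} {N} xs r₂ d≤1+u cols inr with d ≤? u
  ... | yes d≤u = d≤u
  ... | no d≰u = ⊥-elim (<-irrefl refl (≤-trans top≤ (proj₂ (inr (fromℕ< u<d)))))
    where
    u<d = ≰⇒> d≰u
    top≤ : suc N ≤ lookup r₂ (fromℕ< u<d)
    top≤ = subst (_≤ lookup r₂ (fromℕ< u<d)) (lookup-∷ʳ-fromℕ xs (suc N))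
             (cols (fromℕ u) (fromℕ< u<d) (trans (toℕ-fromℕ u) (sym (toℕ-fromℕ< u<d))))

  Covers : ∀ {u d} → ℕ → Vec ℕ u → Vec ℕ d → Set
  Covers N r₁ r₂ = (x : ℕ) → 1 ≤ x → x ≤ N → Occurs x r₁ ⊎ Occurs x r₂

  Rows : ℕ → ℕ → Set
  Rows u d = Vec ℕ u × Vec ℕ d

  -- What is left of an array in RInc_k after deleting its entries larger than N.
  record Valid (u d N : ℕ) (y : Rows u d) : Set where
    constructor valid
    field
      d≤u    : d ≤ u
      inc₁   : StrictlyIncreasing (proj₁ y)
      inc₂   : StrictlyIncreasing (proj₂ y)
      cols   : Columns (proj₁ y) (proj₂ y)
      range₁ : InRange N (proj₁ y)
      range₂ : InRange N (proj₂ y)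
      covers : Covers N (proj₁ y) (proj₂ y)

  append₁ : ∀ {u d} → ℕ → Rows u d → Rows (suc u) d
  append₁ x (r₁ , r₂) = r₁ ∷ʳ x , r₂

  append₂ : ∀ {u d} → ℕ → Rows u d → Rows u (suc d)
  append₂ x (r₁ , r₂) = r₁ , r₂ ∷ʳ x

  append₁₂ : ∀ {u d} → ℕ → Rows u d → Rows (suc u) (suc d)
  append₁₂ x (r₁ , r₂) = r₁ ∷ʳ x , r₂ ∷ʳ x

  Covers-extend : ∀ {u d u′ d′ N} {r₁ : Vec ℕ u} {r₂ : Vec ℕ d} {r₁′ : Vec ℕ u′} {r₂′ : Vec ℕ d′} →
    Covers N r₁ r₂ → (∀ {x} → Occurs x r₁ → Occurs x r₁′) → (∀ {x} → Occurs x r₂ → Occurs x r₂′) →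
    Occurs (suc N) r₁′ ⊎ Occurs (suc N) r₂′ → Covers (suc N) r₁′ r₂′
  Covers-extend cov f₁ f₂ top x 1≤x x≤1+N with m≤n⇒m<n∨m≡n x≤1+N
  ... | inj₂ refl = top
  ... | inj₁ x<1+N with cov x 1≤x (≤-pred x<1+N)
  ...   | inj₁ o = inj₁ (f₁ o)
  ...   | inj₂ o = inj₂ (f₂ o)

  Covers-restrict : ∀ {u d u′ d′ N} {r₁ : Vec ℕ u} {r₂ : Vec ℕ d} {r₁′ : Vec ℕ u′} {r₂′ : Vec ℕ d′} →
    Covers (suc N) r₁ r₂ → (∀ {x} → x ≤ N → Occurs x r₁ → Occurs x r₁′) → (∀ {x} → x ≤ N → Occurs x r₂ → Occurs x r₂′) →
    Covers N r₁′ r₂′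
  Covers-restrict cov f₁ f₂ x 1≤x x≤N with cov x 1≤x (m≤n⇒m≤1+n x≤N)
  ... | inj₁ o = inj₁ (f₁ x≤N o)
  ... | inj₂ o = inj₂ (f₂ x≤N o)

  Occurs-∷ʳ-below : ∀ {n N x} (xs : Vec ℕ n) → x ≤ N → Occurs x (xs ∷ʳ suc N) → Occurs x xs
  Occurs-∷ʳ-below xs x≤N o with Occurs-∷ʳ⁻ xs o
  ... | inj₁ o′   = o′
  ... | inj₂ refl = ⊥-elim (<-irrefl refl (s≤s x≤N))

  valid-append₁ : ∀ {u d N} (y : Rows u d) → Valid u d N y → Valid (suc u) d (suc N) (append₁ (suc N) y)
  valid-append₁ {N = N} (r₁ , r₂) (valid d≤u inc₁ inc₂ cols range₁ range₂ covers) = valid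
    (m≤n⇒m≤1+n d≤u) (StrictlyIncreasing-∷ʳ r₁ (suc N) inc₁ (λ j → s≤s (proj₂ (range₁ j)))) inc₂
    (Columns-∷ʳ₁ r₁ (suc N) r₂ d≤u cols) (InRange-∷ʳ r₁ range₁) (InRange-weaken r₂ range₂)
    (Covers-extend {r₁ = r₁} {r₂ = r₂} {r₁′ = r₁ ∷ʳ suc N} {r₂′ = r₂} covers (Occurs-∷ʳ⁺ r₁) (λ o → o) (inj₁ (Occurs-∷ʳ-last r₁ (suc N))))

  valid-append₂ : ∀ {u d N} (y : Rows u d) → suc d ≤ u → Valid u d N y → Valid u (suc d) (suc N) (append₂ (suc N) y)
  valid-append₂ {N = N} (r₁ , r₂) 1+d≤u (valid d≤u inc₁ inc₂ cols range₁ range₂ covers) = valid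
    1+d≤u inc₁ (StrictlyIncreasing-∷ʳ r₂ (suc N) inc₂ (λ j → s≤s (proj₂ (range₂ j))))
    (Columns-∷ʳ₂ r₁ r₂ (suc N) (λ j → m≤n⇒m≤1+n (proj₂ (range₁ j))) cols) (InRange-weaken r₁ range₁) (InRange-∷ʳ r₂ range₂)
    (Covers-extend {r₁ = r₁} {r₂ = r₂} {r₁′ = r₁} {r₂′ = r₂ ∷ʳ suc N} covers (λ o → o) (Occurs-∷ʳ⁺ r₂) (inj₂ (Occurs-∷ʳ-last r₂ (suc N))))

  valid-append₁₂ : ∀ {u d N} (y : Rows u d) → Valid u d N y → Valid (suc u) (suc d) (suc N) (append₁₂ (suc N) y)
  valid-append₁₂ {N = N} (r₁ , r₂) (valid d≤u inc₁ inc₂ cols range₁ range₂ covers) = valid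
    (s≤s d≤u) (StrictlyIncreasing-∷ʳ r₁ (suc N) inc₁ (λ j → s≤s (proj₂ (range₁ j))))
    (StrictlyIncreasing-∷ʳ r₂ (suc N) inc₂ (λ j → s≤s (proj₂ (range₂ j))))
    (Columns-∷ʳ₂ (r₁ ∷ʳ suc N) r₂ (suc N) (λ j → proj₂ (InRange-∷ʳ r₁ range₁ j)) (Columns-∷ʳ₁ r₁ (suc N) r₂ d≤u cols))
    (InRange-∷ʳ r₁ range₁) (InRange-∷ʳ r₂ range₂)
    (Covers-extend {r₁ = r₁} {r₂ = r₂} {r₁′ = r₁ ∷ʳ suc N} {r₂′ = r₂ ∷ʳ suc N} covers (Occurs-∷ʳ⁺ r₁) (Occurs-∷ʳ⁺ r₂) (inj₁ (Occurs-∷ʳ-last r₁ (suc N))))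

  -- Enumeration of partial arrays by the position of the largest entry

  -- enum₁ lists the valid pairs in which N does not occur in row 2, enum₂ those in which it does.
  mutual
    enum₁ : (u d N : ℕ) → List (Rows u d)
    enum₁ zero    zero zero    = ([] , []) ∷ []
    enum₁ (suc u) d    (suc N) = map (append₁ (suc N)) (enum u d N)
    enum₁ _       _    _       = []

    -- N may go to row 2 alone only below an existing entry of row 1.
    enum₂ : (u d N : ℕ) → List (Rows u d)
    enum₂ (suc u) (suc d) (suc N) = onlyIf (d ≤? u) (map (append₂ (suc N)) (enum (suc u) d N))
                                    ++ map (append₁₂ (suc N)) (enum u d N)
    enum₂ _       _       _       = []

    enum : (u d N : ℕ) → List (Rows u d)
    enum u d N = enum₁ u d N ++ enum₂ u d N

  mutual
    enum₁-valid : ∀ u d N → All (Valid u d N) (enum₁ u d N)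
    enum₁-valid zero    zero    zero    = valid z≤n (λ ()) (λ ()) (λ ()) (λ ()) (λ ()) (λ x 1≤x x≤0 → ⊥-elim (<⇒≱ 1≤x x≤0)) ∷ []
    enum₁-valid zero    zero    (suc N) = []
    enum₁-valid zero    (suc d) N       = []
    enum₁-valid (suc u) d       zero    = []
    enum₁-valid (suc u) d       (suc N) = All.map⁺ (All.map (valid-append₁ _) (enum-valid u d N))

    enum₂-valid : ∀ u d N → All (Valid u d N) (enum₂ u d N)
    enum₂-valid zero    d       N       = []
    enum₂-valid (suc u) zero    N       = []
    enum₂-valid (suc u) (suc d) zero    = []
    enum₂-valid (suc u) (suc d) (suc N) = All.++⁺ (appended₂ (d ≤? u))
                                                 (All.map⁺ (All.map (valid-append₁₂ _) (enum-valid u d N)))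
      where
      appended₂ : (d≤u? : Dec (d ≤ u)) → All (Valid (suc u) (suc d) (suc N)) (onlyIf d≤u? (map (append₂ (suc N)) (enum (suc u) d N)))
      appended₂ (yes d≤u) = All.map⁺ (All.map (valid-append₂ _ (s≤s d≤u)) (enum-valid (suc u) d N))
      appended₂ (no _)    = []

    enum-valid : ∀ u d N → All (Valid u d N) (enum u d N)
    enum-valid u d N = All.++⁺ (enum₁-valid u d N) (enum₂-valid u d N)

  enum₁-top : ∀ u d N → All (λ y → ¬ Occurs N (proj₂ y)) (enum₁ u d N)
  enum₁-top zero    zero    zero    = (λ { (() , _) }) ∷ []
  enum₁-top zero    zero    (suc N) = []
  enum₁-top zero    (suc d) N       = []
  enum₁-top (suc u) d       zero    = []
  enum₁-top (suc u) d       (suc N) = All.map⁺ (All.map (λ {y} v → InRange⇒¬Occurs-suc (proj₂ y) (Valid.range₂ v)) (enum-valid u d N))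

  enum₂-top : ∀ u d N → All (λ y → Occurs N (proj₂ y)) (enum₂ u d N)
  enum₂-top zero    d       N       = []
  enum₂-top (suc u) zero    N       = []
  enum₂-top (suc u) (suc d) zero    = []
  enum₂-top (suc u) (suc d) (suc N) =
    All.++⁺ (All-onlyIf (d ≤? u) (All.map⁺ (All.tabulate λ {y} _ → Occurs-∷ʳ-last (proj₂ y) (suc N))))
            (All.map⁺ (All.tabulate λ {y} _ → Occurs-∷ʳ-last (proj₂ y) (suc N)))

  mutual
    enum₁-sizes : ∀ u d N → All (λ _ → u ≤ N × N ≤ u + d) (enum₁ u d N)
    enum₁-sizes zero    zero    zero    = (z≤n , z≤n) ∷ []
    enum₁-sizes zero    zero    (suc N) = []
    enum₁-sizes zero    (suc d) N       = []
    enum₁-sizes (suc u) d       zero    = []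
    enum₁-sizes (suc u) d       (suc N) = All.map⁺ (All.map (λ (u≤N , N≤u+d) → s≤s u≤N , s≤s N≤u+d) (enum-sizes u d N))

    enum₂-sizes : ∀ u d N → All (λ _ → u ≤ N × N ≤ u + d) (enum₂ u d N)
    enum₂-sizes zero    d       N       = []
    enum₂-sizes (suc u) zero    N       = []
    enum₂-sizes (suc u) (suc d) zero    = []
    enum₂-sizes (suc u) (suc d) (suc N) =
      All.++⁺ (All-onlyIf (d ≤? u) (All.map⁺ (All.map (λ (1+u≤N , N≤1+u+d) → m≤n⇒m≤1+n 1+u≤N , s≤s (≤-trans N≤1+u+d (≤-reflexive (sym (+-suc u d))))) (enum-sizes (suc u) d N))))
              (All.map⁺ (All.map (λ (u≤N , N≤u+d) → s≤s u≤N , s≤s (≤-trans N≤u+d (+-monoʳ-≤ u (n≤1+n d)))) (enum-sizes u d N)))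

    enum-sizes : ∀ u d N → All (λ _ → u ≤ N × N ≤ u + d) (enum u d N)
    enum-sizes u d N = All.++⁺ (enum₁-sizes u d N) (enum₂-sizes u d N)

  append₁-injective : ∀ {u d} x {y y′ : Rows u d} → append₁ x y ≡ append₁ x y′ → y ≡ y′
  append₁-injective x {r₁ , r₂} {r₁′ , r₂′} eq with ∷ʳ-injective r₁ r₁′ (cong proj₁ eq) | cong proj₂ eq
  ... | refl , _ | refl = refl

  append₂-injective : ∀ {u d} x {y y′ : Rows u d} → append₂ x y ≡ append₂ x y′ → y ≡ y′
  append₂-injective x {r₁ , r₂} {r₁′ , r₂′} eq with cong proj₁ eq | ∷ʳ-injective r₂ r₂′ (cong proj₂ eq)
  ... | refl | refl , _ = refl

  append₁₂-injective : ∀ {u d} x {y y′ : Rows u d} → append₁₂ x y ≡ append₁₂ x y′ → y ≡ y′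
  append₁₂-injective x {r₁ , r₂} {r₁′ , r₂′} eq with ∷ʳ-injective r₁ r₁′ (cong proj₁ eq) | ∷ʳ-injective r₂ r₂′ (cong proj₂ eq)
  ... | refl , _ | refl , _ = refl

  mutual
    enum₁-unique : ∀ u d N → Unique (enum₁ u d N)
    enum₁-unique zero    zero    zero    = [] ∷ []
    enum₁-unique zero    zero    (suc N) = []
    enum₁-unique zero    (suc d) N       = []
    enum₁-unique (suc u) d       zero    = []
    enum₁-unique (suc u) d       (suc N) = Unique.map⁺ (append₁-injective (suc N)) (enum-unique u d N)

    -- Only the pairs extended in both rows have N + 1 in row 1.
    enum₂-unique : ∀ u d N → Unique (enum₂ u d N)
    enum₂-unique zero    d       N       = []
    enum₂-unique (suc u) zero    N       = []
    enum₂-unique (suc u) (suc d) zero    = []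
    enum₂-unique (suc u) (suc d) (suc N) =
      Unique.++⁺ (Unique-onlyIf (d ≤? u) (Unique.map⁺ (append₂-injective (suc N)) (enum-unique (suc u) d N)))
                 (Unique.map⁺ (append₁₂-injective (suc N)) (enum-unique u d N))
                 disjoint
      where
      disjoint : ∀ {y} → ¬ (y ∈ onlyIf (d ≤? u) (map (append₂ (suc N)) (enum (suc u) d N)) × y ∈ map (append₁₂ (suc N)) (enum u d N))
      disjoint (∈₂ , ∈₁₂) with ∈-map⁻ (append₂ (suc N)) (onlyIf⊆ (d ≤? u) ∈₂) | ∈-map⁻ (append₁₂ (suc N)) ∈₁₂
      ... | (r₁ , _) , y∈ , refl | (r₁′ , _) , _ , eq =
        InRange⇒¬Occurs-suc r₁ (Valid.range₁ (All.lookup (enum-valid (suc u) d N) y∈))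
          (subst (λ y → Occurs (suc N) (proj₁ y)) (sym eq) (Occurs-∷ʳ-last r₁′ (suc N)))

    enum-unique : ∀ u d N → Unique (enum u d N)
    enum-unique u d N = Unique.++⁺ (enum₁-unique u d N) (enum₂-unique u d N)
      λ (∈₁ , ∈₂) → All.lookup (enum₁-top u d N) ∈₁ (All.lookup (enum₂-top u d N) ∈₂)

  valid-init₁ : ∀ {u d N} (r₁ : Vec ℕ u) (r₂ : Vec ℕ d) → ¬ Occurs (suc N) r₂ →
    Valid (suc u) d (suc N) (append₁ (suc N) (r₁ , r₂)) → Valid u d N (r₁ , r₂)
  valid-init₁ {N = N} r₁ r₂ ¬top (valid d≤1+u inc₁ inc₂ cols range₁ range₂ covers) = valid
    (Columns⇒length r₁ r₂ d≤1+u cols range₂′) (StrictlyIncreasing-init r₁ (suc N) inc₁) inc₂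
    (Columns-init₁ r₁ (suc N) r₂ cols) (InRange-init r₁ (suc N) inc₁ range₁) range₂′
    (Covers-restrict {r₁ = r₁ ∷ʳ suc N} {r₂ = r₂} {r₁′ = r₁} {r₂′ = r₂} covers (Occurs-∷ʳ-below r₁) (λ _ o → o))
    where range₂′ = InRange-without-top r₂ range₂ ¬top

  valid-init₂ : ∀ {u d N} (r₁ : Vec ℕ u) (r₂ : Vec ℕ d) → ¬ Occurs (suc N) r₁ →
    Valid u (suc d) (suc N) (append₂ (suc N) (r₁ , r₂)) → Valid u d N (r₁ , r₂)
  valid-init₂ {N = N} r₁ r₂ ¬top (valid 1+d≤u inc₁ inc₂ cols range₁ range₂ covers) = valid
    (≤-trans (n≤1+n _) 1+d≤u) inc₁ (StrictlyIncreasing-init r₂ (suc N) inc₂)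
    (Columns-init₂ r₁ r₂ (suc N) cols) (InRange-without-top r₁ range₁ ¬top) (InRange-init r₂ (suc N) inc₂ range₂)
    (Covers-restrict {r₁ = r₁} {r₂ = r₂ ∷ʳ suc N} {r₁′ = r₁} {r₂′ = r₂} covers (λ _ o → o) (Occurs-∷ʳ-below r₂))

  valid-init₁₂ : ∀ {u d N} (r₁ : Vec ℕ u) (r₂ : Vec ℕ d) →
    Valid (suc u) (suc d) (suc N) (append₁₂ (suc N) (r₁ , r₂)) → Valid u d N (r₁ , r₂)
  valid-init₁₂ {N = N} r₁ r₂ (valid 1+d≤1+u inc₁ inc₂ cols range₁ range₂ covers) = valid
    (≤-pred 1+d≤1+u) (StrictlyIncreasing-init r₁ (suc N) inc₁) (StrictlyIncreasing-init r₂ (suc N) inc₂)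
    (Columns-init₂ r₁ r₂ (suc N) (Columns-init₁ r₁ (suc N) (r₂ ∷ʳ suc N) cols))
    (InRange-init r₁ (suc N) inc₁ range₁) (InRange-init r₂ (suc N) inc₂ range₂)
    (Covers-restrict {r₁ = r₁ ∷ʳ suc N} {r₂ = r₂ ∷ʳ suc N} {r₁′ = r₁} {r₂′ = r₂} covers (Occurs-∷ʳ-below r₁) (Occurs-∷ʳ-below r₂))

  -- Remove the largest entry N + 1 from the row(s) containing it.
  enum-complete : ∀ u d N (y : Rows u d) → Valid u d N y → y ∈ enum u d N
  enum-complete zero    zero    zero    ([] , []) v = here refl
  enum-complete (suc u) d       zero    (r₁ , r₂) v = ⊥-elim (<⇒≱ (proj₁ (Valid.range₁ v f0)) (proj₂ (Valid.range₁ v f0)))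
  enum-complete zero    (suc d) zero    (r₁ , r₂) v = ⊥-elim (<⇒≱ (proj₁ (Valid.range₂ v f0)) (proj₂ (Valid.range₂ v f0)))
  enum-complete u       d       (suc N) (r₁ , r₂) v with occurs? (suc N) r₁ | occurs? (suc N) r₂
  ... | no ¬top₁ | no ¬top₂ = ⊥-elim ([ ¬top₁ , ¬top₂ ]′ (Valid.covers v (suc N) (s≤s z≤n) ≤-refl))
  enum-complete zero    d       (suc N) (r₁ , r₂) v | yes (() , _) | _
  enum-complete u       zero    (suc N) (r₁ , r₂) v | _ | yes (() , _)
  enum-complete zero    (suc d) (suc N) (r₁ , r₂) v | no _ | yes _ = ⊥-elim (<⇒≱ (s≤s z≤n) (Valid.d≤u v))
  enum-complete (suc u) d       (suc N) (r₁ , r₂) v | yes top₁ | no ¬top₂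
    with initLast r₁
  ... | r₁′ , x , refl with last≡max r₁′ x (Valid.inc₁ v) (Valid.range₁ v) top₁
  ... | refl = ∈-++⁺ˡ (∈-map⁺ (append₁ (suc N)) (enum-complete u d N (r₁′ , r₂) (valid-init₁ r₁′ r₂ ¬top₂ v)))
  enum-complete (suc u) (suc d) (suc N) (r₁ , r₂) v | no ¬top₁ | yes top₂
    with initLast r₂
  ... | r₂′ , x , refl with last≡max r₂′ x (Valid.inc₂ v) (Valid.range₂ v) top₂
  ... | refl = ∈-++⁺ʳ (enum₁ (suc u) (suc d) (suc N)) (∈-++⁺ˡ (∈-onlyIf (d ≤? u) (≤-pred (Valid.d≤u v))
                 (∈-map⁺ (append₂ (suc N)) (enum-complete (suc u) d N (r₁ , r₂′) (valid-init₂ r₁ r₂′ ¬top₁ v)))))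
  enum-complete (suc u) (suc d) (suc N) (r₁ , r₂) v | yes top₁ | yes top₂
    with initLast r₁ | initLast r₂
  ... | r₁′ , x₁ , refl | r₂′ , x₂ , refl
    with last≡max r₁′ x₁ (Valid.inc₁ v) (Valid.range₁ v) top₁ | last≡max r₂′ x₂ (Valid.inc₂ v) (Valid.range₂ v) top₂
  ... | refl | refl = ∈-++⁺ʳ (enum₁ (suc u) (suc d) (suc N)) (∈-++⁺ʳ _
                 (∈-map⁺ (append₁₂ (suc N)) (enum-complete u d N (r₁′ , r₂′) (valid-init₁₂ r₁′ r₂′ v))))

  enum-empty : ∀ u d N → ¬ (d ≤ u × u ≤ N × N ≤ u + d) → enum u d N ≡ []
  enum-empty u d N ¬shape with enum u d N | enum-valid u d N | enum-sizes u d N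
  ... | []    | _     | _      = refl
  ... | _ ∷ _ | v ∷ _ | sizes ∷ _ = ⊥-elim (¬shape (Valid.d≤u v , sizes))

  -- Ascents

  IsAscentOf : ∀ {u d} → Rows u d → ℕ → Set
  IsAscentOf y i = Occurs i (proj₂ y) × Occurs (suc i) (proj₁ y)

  ascent? : ∀ {u d} (y : Rows u d) i → Dec (IsAscentOf y i)
  ascent? y i = occurs? i (proj₂ y) ×-dec occurs? (suc i) (proj₁ y)

  ascentSum : ∀ {u d} → ℕ → Rows u d → ℕ
  ascentSum N y = sum (filter (ascent? y) (upTo N))

  SameAscentsBelow : ∀ {u d u′ d′} → ℕ → Rows u d → Rows u′ d′ → Set
  SameAscentsBelow N y y′ = ∀ {i} → i < N → (IsAscentOf y i → IsAscentOf y′ i) × (IsAscentOf y′ i → IsAscentOf y i)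

  ascentSum-cong : ∀ {u d u′ d′} N (y : Rows u d) (y′ : Rows u′ d′) → SameAscentsBelow N y y′ → ascentSum N y ≡ ascentSum N y′
  ascentSum-cong N y y′ same = cong sum (filter-cong (ascent? y) (ascent? y′) (All.applyUpTo⁺₁ (λ i → i) N same))

  ascentSum-suc : ∀ {u d} N (y : Rows u d) → ascentSum (suc N) y ≡ ascentSum N y + sum (filter (ascent? y) (N ∷ []))
  ascentSum-suc N y = begin
    sum (filter (ascent? y) (upTo (suc N)))                         ≡⟨ cong (sum ∘ filter (ascent? y)) (sym (upTo-∷ʳ N)) ⟩
    sum (filter (ascent? y) (upTo N ++ N ∷ []))                     ≡⟨ cong sum (filter-++ (ascent? y) (upTo N) (N ∷ [])) ⟩
    sum (filter (ascent? y) (upTo N) ++ filter (ascent? y) (N ∷ [])) ≡⟨ sum-++ (filter (ascent? y) (upTo N)) _ ⟩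
    ascentSum N y + sum (filter (ascent? y) (N ∷ []))               ∎

  module _ {u d} (y : Rows u d) (N : ℕ) where
    top-ascent : IsAscentOf y N → sum (filter (ascent? y) (N ∷ [])) ≡ N
    top-ascent asc = trans (cong sum (filter-accept (ascent? y) asc)) (+-identityʳ N)

    top-non-ascent : ¬ IsAscentOf y N → sum (filter (ascent? y) (N ∷ [])) ≡ 0
    top-non-ascent ¬asc = cong sum (filter-reject (ascent? y) ¬asc)

  module _ {u d N : ℕ} (r₁ : Vec ℕ u) (r₂ : Vec ℕ d) where
    ascents-below-append₁ : SameAscentsBelow N (append₁ (suc N) (r₁ , r₂)) (r₁ , r₂)
    ascents-below-append₁ i<N = (λ (o₂ , o₁) → o₂ , Occurs-∷ʳ-below r₁ i<N o₁) , (λ (o₂ , o₁) → o₂ , Occurs-∷ʳ⁺ r₁ o₁)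

    ascents-below-append₂ : SameAscentsBelow N (append₂ (suc N) (r₁ , r₂)) (r₁ , r₂)
    ascents-below-append₂ i<N = (λ (o₂ , o₁) → Occurs-∷ʳ-below r₂ (<⇒≤ i<N) o₂ , o₁) , (λ (o₂ , o₁) → Occurs-∷ʳ⁺ r₂ o₂ , o₁)

    ascents-below-append₁₂ : SameAscentsBelow N (append₁₂ (suc N) (r₁ , r₂)) (r₁ , r₂)
    ascents-below-append₁₂ i<N =
      (λ (o₂ , o₁) → Occurs-∷ʳ-below r₂ (<⇒≤ i<N) o₂ , Occurs-∷ʳ-below r₁ i<N o₁) , (λ (o₂ , o₁) → Occurs-∷ʳ⁺ r₂ o₂ , Occurs-∷ʳ⁺ r₁ o₁)

  vecsOver-complete : ∀ n xs (v : Vec ℕ n) → (∀ j → lookup v j ∈ xs) → v ∈ vecsOver n xs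
  vecsOver-complete zero    xs []      _  = here refl
  vecsOver-complete (suc n) xs (x ∷ v) ∈xs =
    ∈-concat⁺′ (∈-map⁺ (x ∷_) (vecsOver-complete n xs v (∈xs ∘ fs))) (∈-map⁺ (λ y → map (y ∷_) (vecsOver n xs)) (∈xs f0))

  vecsOver-unique : ∀ n xs → Unique xs → Unique (vecsOver n xs)
  vecsOver-unique zero    xs _ = All.[] AllPairs.∷ AllPairs.[]
  vecsOver-unique (suc n) xs u =
    Unique.concat⁺ (All.map⁺ (All.tabulate λ _ → Unique.map⁺ ∷-injectiveʳ (vecsOver-unique n xs u)))
                   (AllPairs.map⁺ (AllPairs.map disjoint u))
    where
    disjoint : ∀ {x y} → x ≢ y → ∀ {w} → ¬ (w ∈ map (x ∷_) (vecsOver n xs) × w ∈ map (y ∷_) (vecsOver n xs))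
    disjoint x≢y (w∈x , w∈y) with ∈-map⁻ _ w∈x | ∈-map⁻ _ w∈y
    ... | _ , _ , refl | _ , _ , eq = x≢y (proj₁ (∷-injective eq))

  range-complete : ∀ {x N} → 1 ≤ x → x ≤ N → x ∈ range N
  range-complete {suc x} _ x<N = ∈-map⁺ suc (∈-upTo⁺ x<N)

  range-unique : ∀ N → Unique (range N)
  range-unique N = Unique.map⁺ suc-injective (Unique.upTo⁺ N)

  toArray : ∀ {n} → Rows n n → Array n
  toArray (r₁ , r₂) = r₁ ∷ r₂ ∷ []

  toArray-injective : ∀ {n} {y y′ : Rows n n} → toArray y ≡ toArray y′ → y ≡ y′
  toArray-injective {y = _ , _} {_ , _} refl = refl

  toArray-rows : ∀ {n} (T : Array n) → toArray (row1 T , row2 T) ≡ T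
  toArray-rows (_ ∷ _ ∷ []) = refl

  arraysOver-complete : ∀ {n N} (r₁ r₂ : Vec ℕ n) → InRange N r₁ → InRange N r₂ → toArray (r₁ , r₂) ∈ arraysOver n N
  arraysOver-complete {n} {N} r₁ r₂ range₁ range₂ = ∈-map⁺ (λ p → proj₁ p ∷ proj₂ p ∷ [])
    (∈-cartesianProduct⁺ (vecsOver-complete n (range N) r₁ (λ j → range-complete (proj₁ (range₁ j)) (proj₂ (range₁ j))))
                         (vecsOver-complete n (range N) r₂ (λ j → range-complete (proj₁ (range₂ j)) (proj₂ (range₂ j)))))

  arraysOver-unique : ∀ n N → Unique (arraysOver n N)
  arraysOver-unique n N = Unique.map⁺ toArray-injective
    (Unique.cartesianProduct⁺ (vecsOver-unique n (range N) (range-unique N)) (vecsOver-unique n (range N) (range-unique N)))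

  valid⇒RInc : ∀ n k (r₁ r₂ : Vec ℕ n) → Valid n n (2 * n ∸ k) (r₁ , r₂) → RInc n k (toArray (r₁ , r₂))
  valid⇒RInc n k r₁ r₂ (valid _ inc₁ inc₂ cols range₁ range₂ covers) = inc₁ , inc₂ , (λ j → cols j j refl) , inRange , covered
    where
    inRange : ∀ i j → 1 ≤ entry (toArray (r₁ , r₂)) i j × entry (toArray (r₁ , r₂)) i j ≤ 2 * n ∸ k
    inRange f0      = range₁
    inRange (fs f0) = range₂
    covered : ∀ x → 1 ≤ x → x ≤ 2 * n ∸ k → ∃₂ λ i j → entry (toArray (r₁ , r₂)) i j ≡ x
    covered x 1≤x x≤N with covers x 1≤x x≤N
    ... | inj₁ (j , eq) = f0 , j , eq
    ... | inj₂ (j , eq) = fs f0 , j , eq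

  RInc⇒valid : ∀ n k (T : Array n) → RInc n k T → Valid n n (2 * n ∸ k) (row1 T , row2 T)
  RInc⇒valid n k T (inc₁ , inc₂ , cols , inRange , covered) = valid ≤-refl inc₁ inc₂ columns (inRange f0) (inRange (fs f0)) covers
    where
    columns : Columns (row1 T) (row2 T)
    columns j j′ eq rewrite toℕ-injective eq = cols j′
    covers : Covers (2 * n ∸ k) (row1 T) (row2 T)
    covers x 1≤x x≤N with covered x 1≤x x≤N
    ... | f0    , j , eq = inj₁ (j , eq)
    ... | fs f0 , j , eq = inj₂ (j , eq)

  RIncList↭enum : ∀ n k → RIncList n k ↭ map toArray (enum n n (2 * n ∸ k))
  RIncList↭enum n k = ∼bag⇒↭ (unique∧set⇒bag
    (Unique.filter⁺ (RInc? n k) (arraysOver-unique n N))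
    (Unique.map⁺ toArray-injective (enum-unique n n N))
    (mk⇔ to from))
    where
    N = 2 * n ∸ k
    to : ∀ {T} → T ∈ RIncList n k → T ∈ map toArray (enum n n N)
    to {T} T∈ = subst (_∈ map toArray (enum n n N)) (toArray-rows T)
      (∈-map⁺ toArray (enum-complete n n N (row1 T , row2 T) (RInc⇒valid n k T (proj₂ (∈-filter⁻ (RInc? n k) {xs = arraysOver n N} T∈)))))
    from : ∀ {T} → T ∈ map toArray (enum n n N) → T ∈ RIncList n k
    from T∈ with ∈-map⁻ toArray T∈
    ... | (r₁ , r₂) , y∈ , refl = ∈-filter⁺ (RInc? n k) (arraysOver-complete r₁ r₂ (Valid.range₁ v) (Valid.range₂ v)) (valid⇒RInc n k r₁ r₂ v)
      where v = All.lookup (enum-valid n n N) y∈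

  rowSum-≥ : ∀ {n} (r : Vec ℕ n) j → lookup r j ≤ rowSum r
  rowSum-≥ (x ∷ r) f0     = m≤m+n x (rowSum r)
  rowSum-≥ (x ∷ r) (fs j) = ≤-trans (rowSum-≥ r j) (m≤n+m (rowSum r) x)

  amaj≡ascentSum : ∀ {n N} (r₁ r₂ : Vec ℕ n) → InRange N r₁ → amaj (toArray (r₁ , r₂)) ≡ ascentSum N (r₁ , r₂)
  amaj≡ascentSum {N = N} r₁ r₂ range₁ = cong sum (filter-upTo-bounds (ascent? (r₁ , r₂)) (suc (rowSum r₂)) N
    (λ ((j , eq) , _) → s≤s (subst (_≤ rowSum r₂) eq (rowSum-≥ r₂ j)))
    (λ (_ , (j , eq)) → subst (_≤ N) eq (proj₂ (range₁ j))))

  module WeightedSums (q : ℕ) where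

    weight : ∀ {u d} → ℕ → Rows u d → ℕ
    weight N y = q ^ ascentSum N y

    S₁ S₂ S : ℕ → ℕ → ℕ → ℕ
    S₁ u d N = sum (map (weight N) (enum₁ u d N))
    S₂ u d N = sum (map (weight N) (enum₂ u d N))
    S  u d N = sum (map (weight N) (enum u d N))

    S-split : ∀ u d N → S u d N ≡ S₁ u d N + S₂ u d N
    S-split u d N = trans (cong sum (map-++ (weight N) (enum₁ u d N) (enum₂ u d N))) (sum-++ (map (weight N) (enum₁ u d N)) _)

    module _ {u d u′ d′} N (y : Rows u d) (y′ : Rows u′ d′) (below : SameAscentsBelow N y′ y) where

      weight-suc-non-ascent : ¬ IsAscentOf y′ N → weight (suc N) y′ ≡ weight N y
      weight-suc-non-ascent ¬asc = cong (q ^_) (begin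
        ascentSum (suc N) y′                               ≡⟨ ascentSum-suc N y′ ⟩
        ascentSum N y′ + sum (filter (ascent? y′) (N ∷ [])) ≡⟨ cong₂ _+_ (ascentSum-cong N y′ y below) (top-non-ascent y′ N ¬asc) ⟩
        ascentSum N y + 0                                  ≡⟨ +-identityʳ _ ⟩
        ascentSum N y                                      ∎)

      weight-suc-ascent : IsAscentOf y′ N → weight (suc N) y′ ≡ q ^ N * weight N y
      weight-suc-ascent asc = begin
        q ^ ascentSum (suc N) y′                                 ≡⟨ cong (q ^_) (ascentSum-suc N y′) ⟩
        q ^ (ascentSum N y′ + sum (filter (ascent? y′) (N ∷ []))) ≡⟨ cong₂ (λ a b → q ^ (a + b)) (ascentSum-cong N y′ y below) (top-ascent y′ N asc) ⟩
        q ^ (ascentSum N y + N)                                  ≡⟨ ^-distribˡ-+-* q (ascentSum N y) N ⟩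
        q ^ ascentSum N y * q ^ N                                ≡⟨ *-comm (q ^ ascentSum N y) (q ^ N) ⟩
        q ^ N * weight N y                                       ∎

    -- Appending N + 1 to row 1 creates the ascent N exactly when N lies in row 2.
    S-append-to-row₁ : ∀ {u′ d′} u d N (f : Rows u d → Rows u′ d′) →
      (∀ y → ¬ Occurs N (proj₂ y) → weight (suc N) (f y) ≡ weight N y) →
      (∀ y → Occurs N (proj₂ y) → weight (suc N) (f y) ≡ q ^ N * weight N y) →
      sum (map (weight (suc N)) (map f (enum u d N))) ≡ S₁ u d N + q ^ N * S₂ u d N
    S-append-to-row₁ u d N f unchanged raised = begin
      sum (map (weight (suc N)) (map f (enum u d N)))       ≡⟨ cong sum (sym (map-∘ (enum u d N))) ⟩
      sum (map w (enum₁ u d N ++ enum₂ u d N))              ≡⟨ cong sum (map-++ w (enum₁ u d N) (enum₂ u d N)) ⟩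
      sum (map w (enum₁ u d N) ++ map w (enum₂ u d N))      ≡⟨ sum-++ (map w (enum₁ u d N)) (map w (enum₂ u d N)) ⟩
      sum (map w (enum₁ u d N)) + sum (map w (enum₂ u d N))
        ≡⟨ cong₂ _+_ (cong sum (map-cong-local (All.map (unchanged _) (enum₁-top u d N))))
                     (cong sum (map-cong-local (All.map (raised _) (enum₂-top u d N)))) ⟩
      S₁ u d N + sum (map (λ y → q ^ N * weight N y) (enum₂ u d N)) ≡⟨ cong (_+_ (S₁ u d N)) (sum-map-*ˡ (q ^ N) (weight N) (enum₂ u d N)) ⟩
      S₁ u d N + q ^ N * S₂ u d N                                  ∎
      where w = weight (suc N) ∘ f

    S₁-step : ∀ u d N → S₁ (suc u) d (suc N) ≡ S₁ u d N + q ^ N * S₂ u d N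
    S₁-step u d N = S-append-to-row₁ u d N (append₁ (suc N))
      (λ (r₁ , r₂) ¬top → weight-suc-non-ascent N (r₁ , r₂) (append₁ (suc N) (r₁ , r₂)) (ascents-below-append₁ r₁ r₂) (λ (top , _) → ¬top top))
      (λ (r₁ , r₂) top → weight-suc-ascent N (r₁ , r₂) (append₁ (suc N) (r₁ , r₂)) (ascents-below-append₁ r₁ r₂) (top , Occurs-∷ʳ-last r₁ (suc N)))

    -- Appending N + 1 to both rows changes the ascents as appending it to row 1 alone does.
    S₂-step : ∀ u d N → d ≤ u → S₂ (suc u) (suc d) (suc N) ≡ S (suc u) d N + S₁ (suc u) d (suc N)
    S₂-step u d N d≤u = begin
      S₂ (suc u) (suc d) (suc N)                    ≡⟨ cong (λ xs → sum (map w (xs ++ both))) (onlyIf-yes (d ≤? u) d≤u) ⟩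
      sum (map w (two ++ both))                     ≡⟨ cong sum (map-++ w two both) ⟩
      sum (map w two ++ map w both)                 ≡⟨ sum-++ (map w two) (map w both) ⟩
      sum (map w two) + sum (map w both)            ≡⟨ cong₂ _+_ appended₂ appended₁₂ ⟩
      S (suc u) d N + (S₁ u d N + q ^ N * S₂ u d N) ≡⟨ cong (_+_ (S (suc u) d N)) (sym (S₁-step u d N)) ⟩
      S (suc u) d N + S₁ (suc u) d (suc N)          ∎
      where
      w = weight (suc N)
      two = map (append₂ (suc N)) (enum (suc u) d N)
      both = map (append₁₂ (suc N)) (enum u d N)
      appended₂ : sum (map w two) ≡ S (suc u) d N
      appended₂ = cong sum (trans (sym (map-∘ (enum (suc u) d N))) (map-cong-local (All.map
        (λ {(r₁ , r₂)} v → weight-suc-non-ascent N (r₁ , r₂) (append₂ (suc N) (r₁ , r₂)) (ascents-below-append₂ r₁ r₂)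
                             (λ (_ , top) → InRange⇒¬Occurs-suc r₁ (Valid.range₁ v) top))
        (enum-valid (suc u) d N))))
      appended₁₂ : sum (map w both) ≡ S₁ u d N + q ^ N * S₂ u d N
      appended₁₂ = S-append-to-row₁ u d N (append₁₂ (suc N))
        (λ (r₁ , r₂) ¬top → weight-suc-non-ascent N (r₁ , r₂) (append₁₂ (suc N) (r₁ , r₂)) (ascents-below-append₁₂ r₁ r₂) (λ (top , _) → ¬top (Occurs-∷ʳ-below r₂ ≤-refl top)))
        (λ (r₁ , r₂) top → weight-suc-ascent N (r₁ , r₂) (append₁₂ (suc N) (r₁ , r₂)) (ascents-below-append₁₂ r₁ r₂) (Occurs-∷ʳ⁺ r₂ top , Occurs-∷ʳ-last r₁ (suc N)))

    S-empty : ∀ u d N → ¬ (d ≤ u × u ≤ N × N ≤ u + d) → S u d N ≡ 0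
    S-empty u d N ¬shape = cong (sum ∘ map (weight N)) (enum-empty u d N ¬shape)

    S₁-suc-empty : ∀ u d N → ¬ (d ≤ u × u ≤ N × N ≤ u + d) → S₁ (suc u) d (suc N) ≡ 0
    S₁-suc-empty u d N ¬shape = cong (λ ys → sum (map (weight (suc N)) (map (append₁ (suc N)) ys))) (enum-empty u d N ¬shape)

    amajGF≡S : ∀ n k → amajGF n k q ≡ S n n (2 * n ∸ k)
    amajGF≡S n k = begin
      sum (map (λ T → q ^ amaj T) (RIncList n k))                  ≡⟨ sum-↭ (↭.map⁺ (λ T → q ^ amaj T) (RIncList↭enum n k)) ⟩
      sum (map (λ T → q ^ amaj T) (map toArray (enum n n N)))      ≡⟨ cong sum (sym (map-∘ (enum n n N))) ⟩
      sum (map (λ y → q ^ amaj (toArray y)) (enum n n N))          ≡⟨ cong sum (map-cong-local (All.map (λ {(r₁ , r₂)} v → cong (q ^_) (amaj≡ascentSum r₁ r₂ (Valid.range₁ v))) (enum-valid n n N))) ⟩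
      S n n N                                                      ∎
      where
      N = 2 * n ∸ k

open Enumeration

module Coordinates (q : ℕ) where
  open WeightedSums q

  -- b entries only in row 2, b + e only in row 1, c in both rows.
  W₁ W₂ : ℕ → ℕ → ℕ → ℕ
  W₁ b e c = S₁ (b + e + c) (b + c) (b + b + e + c)
  W₂ b e c = S₂ (b + e + c) (b + c) (b + b + e + c)

  W₁-step : ∀ b e c → W₁ b (suc e) c ≡ W₁ b e c + q ^ (b + b + e + c) * W₂ b e c
  W₁-step b e c rewrite +-suc b e | +-suc (b + b) e = S₁-step (b + e + c) (b + c) (b + b + e + c)

  W₂-step-b≡0 : ∀ e c → W₂ 0 e (suc c) ≡ W₁ 0 (suc e) c
  W₂-step-b≡0 e c rewrite +-suc e c =
    trans (S₂-step (e + c) c (e + c) (m≤n+m c e)) (cong (_+ S₁ (suc (e + c)) c (suc (e + c))) (S-empty (suc (e + c)) c (e + c) λ (_ , 1+N≤N , _) → 1+n≰n 1+N≤N))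

  W₂-step-c≡0 : ∀ b e → W₂ (suc b) e 0 ≡ W₁ b (suc e) 0 + W₂ b (suc e) 0
  W₂-step-c≡0 b e rewrite +-suc b e | +-suc b b | +-suc (b + b) e = begin
    S₂ (suc u) (suc d) (suc N)        ≡⟨ S₂-step u d N (+-monoˡ-≤ 0 (m≤m+n b e)) ⟩
    S (suc u) d N + S₁ (suc u) d (suc N) ≡⟨ cong₂ _+_ (S-split (suc u) d N) (S₁-suc-empty u d N λ (_ , _ , N≤u+d) → 1+n≰n (≤-trans N≤u+d (≤-reflexive (u+d≡ b e)))) ⟩
    S₁ (suc u) d N + S₂ (suc u) d N + 0 ≡⟨ +-identityʳ _ ⟩
    S₁ (suc u) d N + S₂ (suc u) d N   ∎
    where
    u = b + e + 0
    d = b + 0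
    N = suc (b + b + e + 0)
    u+d≡ : ∀ b e → b + e + 0 + (b + 0) ≡ b + b + e + 0
    u+d≡ = solve-∀

  W₂-step : ∀ b e c → W₂ (suc b) e (suc c) ≡ W₁ b (suc e) (suc c) + W₂ b (suc e) (suc c) + W₁ (suc b) (suc e) c
  W₂-step b e c rewrite +-suc b e | +-suc b b | +-suc (b + b) e | +-suc (b + e) c | +-suc b c | +-suc (b + b + e) c =
    trans (S₂-step (suc (b + e + c)) (suc (b + c)) (suc (suc (b + b + e + c))) (s≤s (+-monoˡ-≤ c (m≤m+n b e))))
          (cong (_+ S₁ (suc (suc (b + e + c))) (suc (b + c)) (suc (suc (suc (b + b + e + c))))) (S-split (suc (suc (b + e + c))) (suc (b + c)) (suc (suc (b + b + e + c)))))

  W₁-e≡0 : ∀ b c s → b + c ≡ suc s → W₁ b 0 c ≡ 0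
  W₁-e≡0 (suc b) c _ refl = S₁-suc-empty (b + 0 + c) (suc (b + c)) (b + suc b + 0 + c)
    λ (d≤u , _) → 1+n≰n (≤-trans d≤u (≤-reflexive (cong (_+ c) (+-identityʳ b))))
  W₁-e≡0 zero (suc c) _ refl = S₁-suc-empty c (suc c) c λ (d≤u , _) → 1+n≰n d≤u

  W₂-b≡c≡0 : ∀ e → W₂ 0 e 0 ≡ 0
  W₂-b≡c≡0 zero    = refl
  W₂-b≡c≡0 (suc e) = refl

  W₁-b≡c≡0 : ∀ e → W₁ 0 e 0 ≡ 1
  W₁-b≡c≡0 zero    = refl
  W₁-b≡c≡0 (suc e) rewrite W₁-step 0 e 0 | W₁-b≡c≡0 e | W₂-b≡c≡0 e = cong suc (*-zeroʳ (q ^ (e + 0)))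

  Ŵ₁ Ŵ₂ : ℕ → ℕ → ℕ → ℕ
  Ŵ₁ b e c = W₁ b e c * ([ b ]!q q * [ c ]!q q * [ b + e ]!q q)
  Ŵ₂ b e c = W₂ b e c * ([ b ]!q q * [ c ]!q q * [ suc (b + e) ]!q q)

  Ŵ₁-step : ∀ b e c → Ŵ₁ b (suc e) c ≡ [ suc (b + e) ]q q * Ŵ₁ b e c + q ^ (b + b + e + c) * Ŵ₂ b e c
  Ŵ₁-step b e c rewrite W₁-step b e c with W₁ b e c | W₂ b e c
  ... | Z | P rewrite +-suc b e with [ b ]!q q | [ c ]!q q | [ b + e ]!q q | [ b + e ]q q | q ^ (b + b + e + c)
  ... | Fb | Fc | Fbe | Ibe | Q = solve (Z ∷ P ∷ Fb ∷ Fc ∷ Fbe ∷ Ibe ∷ Q ∷ q ∷ [])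

  Ŵ₂-step-b≡0 : ∀ e c → Ŵ₂ 0 e (suc c) ≡ [ suc c ]q q * Ŵ₁ 0 (suc e) c
  Ŵ₂-step-b≡0 e c rewrite W₂-step-b≡0 e c with W₁ 0 (suc e) c | [ c ]!q q | [ suc e ]!q q | [ c ]q q
  ... | Z | Fc | Fe | Ic = solve (Z ∷ Fc ∷ Fe ∷ Ic ∷ q ∷ [])

  Ŵ₂-step-c≡0 : ∀ b e → Ŵ₂ (suc b) e 0 ≡ [ suc b ]q q * ([ suc (suc (b + e)) ]q q * Ŵ₁ b (suc e) 0 + Ŵ₂ b (suc e) 0)
  Ŵ₂-step-c≡0 b e rewrite W₂-step-c≡0 b e with W₁ b (suc e) 0 | W₂ b (suc e) 0
  ... | Z | P rewrite +-suc b e with [ b ]!q q | [ b ]q q | [ b + e ]!q q | [ b + e ]q q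
  ... | Fb | Ib | Fbe | Ibe = solve (Z ∷ P ∷ Fb ∷ Ib ∷ Fbe ∷ Ibe ∷ q ∷ [])

  Ŵ₂-step : ∀ b e c → Ŵ₂ (suc b) e (suc c)
    ≡ [ suc b ]q q * ([ suc (suc (b + e)) ]q q * Ŵ₁ b (suc e) (suc c) + Ŵ₂ b (suc e) (suc c)) + [ suc c ]q q * Ŵ₁ (suc b) (suc e) c
  Ŵ₂-step b e c rewrite W₂-step b e c with W₁ b (suc e) (suc c) | W₂ b (suc e) (suc c) | W₁ (suc b) (suc e) c
  ... | Z₁ | P₁ | Z₂ rewrite +-suc b e with [ b ]!q q | [ b ]q q | [ c ]!q q | [ c ]q q | [ b + e ]!q q | [ b + e ]q q
  ... | Fb | Ib | Fc | Ic | Fbe | Ibe = solve (Z₁ ∷ P₁ ∷ Z₂ ∷ Fb ∷ Ib ∷ Fc ∷ Ic ∷ Fbe ∷ Ibe ∷ q ∷ [])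

  -- qtri c = q ^ (c choose 2)
  qtri : ℕ → ℕ
  qtri zero    = 1
  qtri (suc c) = q ^ c * qtri c

  mutual
    Ŵ₁-closed : ∀ b e c s → b + c ≡ suc s → Ŵ₁ b e c ≡ qtri c * [ b + e + s ]!q q * core₁ q b e c
    Ŵ₁-closed b zero c s h rewrite W₁-e≡0 b c s h =
      sym (trans (cong (qtri c * [ b + 0 + s ]!q q *_) (*-zeroʳ (q ^ (b + b + c)))) (*-zeroʳ (qtri c * [ b + 0 + s ]!q q)))
    Ŵ₁-closed b (suc e) c s h = begin
      Ŵ₁ b (suc e) c                                            ≡⟨ Ŵ₁-step b e c ⟩
      [ suc (b + e) ]q q * Ŵ₁ b e c + q ^ (b + b + e + c) * Ŵ₂ b e c
        ≡⟨ cong₂ (λ z w → [ suc (b + e) ]q q * z + q ^ (b + b + e + c) * w) (Ŵ₁-closed b e c s h) (Ŵ₂-closed b e c s h) ⟩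
      [ suc (b + e) ]q q * (qtri c * [ b + e + s ]!q q * core₁ q b e c) + q ^ (b + b + e + c) * (qtri c * [ b + e + s ]!q q * core₂ q b e s)
        ≡⟨ factor₁-step (qtri c) ([ b + e + s ]!q q) ([ suc (b + e) ]q q) (core₁ q b e c) (q ^ (b + b + e + c)) (core₂ q b e s)
                  ([ suc (b + e + s) ]q q) (core₁ q b (suc e) c) (core₁-step q b e c s h) ⟩
      qtri c * [ suc (b + e + s) ]!q q * core₁ q b (suc e) c      ≡⟨ cong (λ i → qtri c * [ i ]!q q * core₁ q b (suc e) c) (cong (_+ s) (sym (+-suc b e))) ⟩
      qtri c * [ b + suc e + s ]!q q * core₁ q b (suc e) c        ∎

    Ŵ₂-closed : ∀ b e c s → b + c ≡ suc s → Ŵ₂ b e c ≡ qtri c * [ b + e + s ]!q q * core₂ q b e s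
    Ŵ₂-closed zero e (suc zero) ._ refl rewrite Ŵ₂-step-b≡0 e 0 | W₁-b≡c≡0 (suc e) | +-identityʳ e
      with [ e ]!q q | [ e ]q q
    ... | Fe | Ie = solve (Fe ∷ Ie ∷ q ∷ [])
    Ŵ₂-closed zero e (suc (suc c)) ._ refl = begin
      Ŵ₂ 0 e (suc (suc c))                           ≡⟨ Ŵ₂-step-b≡0 e (suc c) ⟩
      [ suc (suc c) ]q q * Ŵ₁ 0 (suc e) (suc c)      ≡⟨ cong ([ suc (suc c) ]q q *_) (Ŵ₁-closed 0 (suc e) (suc c) c refl) ⟩
      [ suc (suc c) ]q q * (qtri (suc c) * [ suc (e + c) ]!q q * core₁ q 0 (suc e) (suc c))
        ≡⟨ factor₂-step-b≡0 (qtri (suc c)) ([ suc (e + c) ]!q q) ([ suc (suc c) ]q q) (core₁ q 0 (suc e) (suc c))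
                      (q ^ suc c) (core₂ q 0 e (suc c)) (core₂-step-b≡0 q e c) ⟩
      q ^ suc c * qtri (suc c) * [ suc (e + c) ]!q q * core₂ q 0 e (suc c)
        ≡⟨ cong (λ i → qtri (suc (suc c)) * [ i ]!q q * core₂ q 0 e (suc c)) (sym (+-suc e c)) ⟩
      qtri (suc (suc c)) * [ e + suc c ]!q q * core₂ q 0 e (suc c) ∎
    Ŵ₂-closed (suc zero) e zero ._ refl rewrite Ŵ₂-step-c≡0 0 e | W₁-b≡c≡0 (suc e) | W₂-b≡c≡0 (suc e) | +-identityʳ e
      with [ e ]!q q | [ e ]q q
    ... | Fe | Ie = solve (Fe ∷ Ie ∷ q ∷ [])
    Ŵ₂-closed (suc (suc b)) e zero ._ refl = begin
      Ŵ₂ (suc (suc b)) e 0   ≡⟨ Ŵ₂-step-c≡0 (suc b) e ⟩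
      [ suc (suc b) ]q q * ([ suc (suc (suc b + e)) ]q q * Ŵ₁ (suc b) (suc e) 0 + Ŵ₂ (suc b) (suc e) 0)
        ≡⟨ cong₂ (λ z w → [ suc (suc b) ]q q * ([ suc (suc (suc b + e)) ]q q * z + w)) (Ŵ₁-closed (suc b) (suc e) 0 (b + 0) refl) (Ŵ₂-closed (suc b) (suc e) 0 (b + 0) refl) ⟩
      [ suc (suc b) ]q q * ([ suc (suc (suc b + e)) ]q q * (1 * G * core₁ q (suc b) (suc e) 0) + 1 * G * core₂ q (suc b) (suc e) (b + 0))
        ≡⟨ factor₂-step-c≡0 1 G ([ suc (suc b) ]q q) ([ suc (suc (suc b + e)) ]q q) (core₁ q (suc b) (suc e) 0) (core₂ q (suc b) (suc e) (b + 0))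
                     ([ suc (suc b + suc e + (b + 0)) ]q q) (core₂ q (suc (suc b)) e (suc b + 0)) (core₂-step-c≡0 q b e) ⟩
      1 * [ suc (suc b + suc e + (b + 0)) ]!q q * core₂ q (suc (suc b)) e (suc b + 0)
        ≡⟨ cong (λ i → 1 * [ suc i ]!q q * core₂ q (suc (suc b)) e (suc b + 0)) (index b e) ⟩
      1 * [ suc (suc b) + e + (suc b + 0) ]!q q * core₂ q (suc (suc b)) e (suc b + 0) ∎
      where
      G = [ suc b + suc e + (b + 0) ]!q q
      index : ∀ b e → suc b + suc e + (b + 0) ≡ suc b + e + (suc b + 0)
      index = solve-∀
    Ŵ₂-closed (suc b) e (suc c) ._ refl = begin
      Ŵ₂ (suc b) e (suc c)     ≡⟨ Ŵ₂-step b e c ⟩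
      [ suc b ]q q * ([ suc (suc (b + e)) ]q q * Ŵ₁ b (suc e) (suc c) + Ŵ₂ b (suc e) (suc c)) + [ suc c ]q q * Ŵ₁ (suc b) (suc e) c
        ≡⟨ cong₃ (λ z₁ w₁ z₃ → [ suc b ]q q * ([ suc (suc (b + e)) ]q q * z₁ + w₁) + [ suc c ]q q * z₃)
                 (Ŵ₁-closed b (suc e) (suc c) (b + c) (+-suc b c)) (Ŵ₂-closed b (suc e) (suc c) (b + c) (+-suc b c)) (Ŵ₁-closed (suc b) (suc e) c (b + c) refl) ⟩
      [ suc b ]q q * ([ suc (suc (b + e)) ]q q * (q ^ c * qtri c * G * core₁ q b (suc e) (suc c)) + q ^ c * qtri c * G * core₂ q b (suc e) (b + c))
        + [ suc c ]q q * (qtri c * ([ M ]q q * G) * core₁ q (suc b) (suc e) c)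
        ≡⟨ factor₂-step (qtri c) G ([ suc b ]q q) ([ suc (suc (b + e)) ]q q) (q ^ c) (core₁ q b (suc e) (suc c)) (core₂ q b (suc e) (b + c))
                     ([ suc c ]q q) ([ M ]q q) (core₁ q (suc b) (suc e) c) (core₂ q (suc b) e (b + suc c)) (core₂-step q b e c) ⟩
      q ^ c * qtri c * ([ M ]q q * G) * core₂ q (suc b) e (b + suc c)
        ≡⟨ cong (λ i → qtri (suc c) * [ suc i ]!q q * core₂ q (suc b) e (b + suc c)) (index b e c) ⟩
      qtri (suc c) * [ suc b + e + (b + suc c) ]!q q * core₂ q (suc b) e (b + suc c) ∎
      where
      G = [ b + suc e + (b + c) ]!q q
      M = suc (b + suc e + (b + c))
      index : ∀ b e c → b + suc e + (b + c) ≡ b + e + (b + suc c)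
      index = solve-∀

2[m+k]∸k : ∀ m k → 2 * (m + k) ∸ k ≡ m + m + k
2[m+k]∸k m k = trans (cong (_∸ k) (split m k)) (m+n∸n≡m (m + m + k) k)
  where split : ∀ m k → 2 * (m + k) ≡ m + m + k + k
        split = solve-∀

2[m+k]∸k∸k : ∀ m k → 2 * (m + k) ∸ k ∸ k ≡ m + m
2[m+k]∸k∸k m k = trans (cong (_∸ k) (2[m+k]∸k m k)) (m+n∸n≡m (m + m) k)

2[m+k]∸2k : ∀ m k → 2 * (m + k) ∸ 2 * k ≡ m + m
2[m+k]∸2k m k = trans (cong (_∸ 2 * k) (split m k)) (m+n∸n≡m (m + m) (2 * k))
  where split : ∀ m k → 2 * (m + k) ≡ m + m + 2 * k
        split = solve-∀

module _ (q : ℕ) where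
  open WeightedSums q
  open Coordinates q

  choose₂-suc : ∀ k → suc k * (suc k ∸ 1) / 2 ≡ k + k * (k ∸ 1) / 2
  choose₂-suc k = begin
    suc k * k / 2               ≡⟨ cong (_/ 2) (double k) ⟩
    (k * 2 + k * (k ∸ 1)) / 2   ≡⟨ +-distrib-/-∣ˡ (k * (k ∸ 1)) (divides-refl k) ⟩
    k * 2 / 2 + k * (k ∸ 1) / 2 ≡⟨ cong (_+ k * (k ∸ 1) / 2) (m*n/n≡m k 2) ⟩
    k + k * (k ∸ 1) / 2         ∎
    where
    double : ∀ k → suc k * k ≡ k * 2 + k * (k ∸ 1)
    double zero    = refl
    double (suc j) = lemma j
      where lemma : ∀ j → suc (suc j) * suc j ≡ suc j * 2 + suc j * j
            lemma = solve-∀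

  q^choose₂≡qtri : ∀ k → q ^ (k * (k ∸ 1) / 2) ≡ qtri k
  q^choose₂≡qtri zero    = refl
  q^choose₂≡qtri (suc k) = begin
    q ^ (suc k * (suc k ∸ 1) / 2)   ≡⟨ cong (q ^_) (choose₂-suc k) ⟩
    q ^ (k + k * (k ∸ 1) / 2)       ≡⟨ ^-distribˡ-+-* q k _ ⟩
    q ^ k * q ^ (k * (k ∸ 1) / 2)   ≡⟨ cong (q ^ k *_) (q^choose₂≡qtri k) ⟩
    q ^ k * qtri k                  ∎

  amajGF-closed : ∀ m k s → m + k ≡ suc s → amajGF (m + k) k q * ([ m ]!q q * [ k ]!q q * [ suc m ]!q q) ≡ qtri k * [ m + m + k ]!q q
  amajGF-closed m k s h = begin
    amajGF (m + k) k q * D                      ≡⟨ cong (_* D) (amajGF≡S (m + k) k) ⟩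
    S (m + k) (m + k) (2 * (m + k) ∸ k) * D     ≡⟨ cong₂ (λ u N → S u (m + k) N * D) (cong (_+ k) (sym (+-identityʳ m)))
                                                         (trans (2[m+k]∸k m k) (cong (_+ k) (sym (+-identityʳ (m + m))))) ⟩
    S (m + 0 + k) (m + k) (m + m + 0 + k) * D   ≡⟨ cong (_* D) (S-split (m + 0 + k) (m + k) (m + m + 0 + k)) ⟩
    (W₁ m 0 k + W₂ m 0 k) * D                   ≡⟨ cong (λ w → (w + W₂ m 0 k) * D) (W₁-e≡0 m k s h) ⟩
    W₂ m 0 k * D                                ≡⟨ cong (λ i → W₂ m 0 k * ([ m ]!q q * [ k ]!q q * [ suc i ]!q q)) (sym (+-identityʳ m)) ⟩
    Ŵ₂ m 0 k                                    ≡⟨ Ŵ₂-closed m 0 k s h ⟩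
    qtri k * [ m + 0 + s ]!q q * core₂ q m 0 s   ≡⟨ drop-zero-term (qtri k) ([ m + 0 + s ]!q q) ([ suc (m + 0 + s) ]q q) (q ^ suc m) ([ s ]q q) ⟩
    qtri k * [ suc (m + 0 + s) ]!q q            ≡⟨ cong (λ i → qtri k * [ i ]!q q) size ⟩
    qtri k * [ m + m + k ]!q q                  ∎
    where
    D = [ m ]!q q * [ k ]!q q * [ suc m ]!q q
    drop-zero-term : ∀ t g i x y → t * g * (i + x * 0 * y) ≡ t * (i * g)
    drop-zero-term = solve-∀
    size : suc (m + 0 + s) ≡ m + m + k
    size = begin
      suc (m + 0 + s) ≡⟨ cong (λ i → suc (i + s)) (+-identityʳ m) ⟩
      suc (m + s)     ≡⟨ sym (+-suc m s) ⟩
      m + suc s       ≡⟨ cong (_+_ m) (sym h) ⟩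
      m + (m + k)     ≡⟨ sym (+-assoc m m k) ⟩
      m + m + k       ∎

  -- The theorem with its denominators cleared, the indices written exactly as in qbinom.
  Cleared : ℕ → ℕ → Set
  Cleared n k =
    amajGF n k q * ([ suc (n ∸ k) ]q q * ([ k ]!q q * [ 2 * n ∸ k ∸ k ]!q q) * ([ n ∸ k ]!q q * [ 2 * n ∸ 2 * k ∸ (n ∸ k) ]!q q))
      ≡ q ^ (k * (k ∸ 1) / 2) * [ 2 * n ∸ k ]!q q * [ 2 * n ∸ 2 * k ]!q q

  cleared-m+k : ∀ m k → 1 ≤ m + k → Cleared (m + k) k
  cleared-m+k m k 1≤m+k = begin
    A * ([ suc (m + k ∸ k) ]q q * ([ k ]!q q * [ 2 * (m + k) ∸ k ∸ k ]!q q) * ([ m + k ∸ k ]!q q * [ 2 * (m + k) ∸ 2 * k ∸ (m + k ∸ k) ]!q q))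
      ≡⟨ cong₃ (λ a b c → A * ([ suc a ]q q * ([ k ]!q q * [ b ]!q q) * ([ a ]!q q * [ c ]!q q)))
               (m+n∸n≡m m k) (2[m+k]∸k∸k m k) (trans (cong₂ _∸_ (2[m+k]∸2k m k) (m+n∸n≡m m k)) (m+n∸m≡n m m)) ⟩
    A * ([ suc m ]q q * ([ k ]!q q * [ m + m ]!q q) * ([ m ]!q q * [ m ]!q q))
      ≡⟨ regroup A ([ suc m ]q q) ([ k ]!q q) ([ m + m ]!q q) ([ m ]!q q) ⟩
    A * ([ m ]!q q * [ k ]!q q * [ suc m ]!q q) * [ m + m ]!q q
      ≡⟨ cong (_* [ m + m ]!q q) (amajGF-closed m k (pred (m + k)) (sym (suc-pred (m + k) {{>-nonZero 1≤m+k}}))) ⟩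
    qtri k * [ m + m + k ]!q q * [ m + m ]!q q
      ≡⟨ cong₃ (λ t a b → t * [ a ]!q q * [ b ]!q q) (sym (q^choose₂≡qtri k)) (sym (2[m+k]∸k m k)) (sym (2[m+k]∸2k m k)) ⟩
    q ^ (k * (k ∸ 1) / 2) * [ 2 * (m + k) ∸ k ]!q q * [ 2 * (m + k) ∸ 2 * k ]!q q ∎
    where
    A = amajGF (m + k) k q
    regroup : ∀ A i fk fmm fm → A * (i * (fk * fmm) * (fm * fm)) ≡ A * (fm * fk * (i * fm)) * fmm
    regroup = solve-∀

  cleared : ∀ n k → 1 ≤ n → k ≤ n → Cleared n k
  cleared n k 1≤n k≤n = subst (λ n → Cleared n k) (m∸n+n≡m k≤n) (cleared-m+k (n ∸ k) k (subst (1 ≤_) (sym (m∸n+n≡m k≤n)) 1≤n))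

≃-cross : ∀ A a b c x y z .{{_ : NonZero x}} .{{_ : NonZero y}} .{{_ : NonZero z}} →
  A * (x * y * z) ≡ a * b * c → (+ A) /ℚ 1 ≃ ((+ a) /ℚ x) *ℚ ((+ b) /ℚ y) *ℚ ((+ c) /ℚ z)
≃-cross A a b c (suc x) (suc y) (suc z) eq = *≡* (begin
  + A ℤ* + (suc x * suc y * suc z) ≡⟨ sym (ℤ.pos-* A _) ⟩
  + (A * (suc x * suc y * suc z))  ≡⟨ cong +_ eq ⟩
  + (a * b * c)                    ≡⟨ trans (ℤ.pos-* (a * b) c) (cong (_ℤ* + c) (ℤ.pos-* a b)) ⟩
  + a ℤ* + b ℤ* + c                ≡⟨ sym (ℤ.*-identityʳ _) ⟩
  + a ℤ* + b ℤ* + c ℤ* + 1         ∎)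

theorem1p4 : (n k q : ℕ) → 1 ≤ n → k ≤ n →
    (+ amajGF n k q) /ℚ 1
      ≃ ((+ (q ^ (k * (k ∸ 1) / 2))) /ℚ [ suc (n ∸ k) ]q q)
          *ℚ qbinom (2 * n ∸ k) k q
          *ℚ qbinom (2 * n ∸ 2 * k) (n ∸ k) q
theorem1p4 n k q 1≤n k≤n =
  ≃-cross (amajGF n k q) (q ^ (k * (k ∸ 1) / 2)) ([ 2 * n ∸ k ]!q q) ([ 2 * n ∸ 2 * k ]!q q)
          ([ suc (n ∸ k) ]q q) ([ k ]!q q * [ 2 * n ∸ k ∸ k ]!q q) ([ n ∸ k ]!q q * [ 2 * n ∸ 2 * k ∸ (n ∸ k) ]!q q)
          {{_}} {{prod-nonZero {k} {2 * n ∸ k ∸ k} {q}}} {{prod-nonZero {n ∸ k} {2 * n ∸ 2 * k ∸ (n ∸ k)} {q}}}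
          (cleared q n k 1≤n k≤n)
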